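{- Let $n\ge1$ and let $\mathcal{A}^s_n$ be the set of signed arc permutations in $B_n$. With the convention $x_0:=1$, $$ \sum_{\pi\in\mathcal{A}^s_n} \mathbf{x}^{\mathrm{Des}(\pi)} \mathbf{y}^{\mathrm{Neg}(\pi)}=\prod_{i=1}^{n}(1+x_{i-1}y_{i})\left(1+\sum_{j=1}^{n-1} \frac{(x_{j}+x_{j-1}y_{j})(1+y_{j+1})}{(1+x_{j-1}y_{j})(1+x_{j}y_{j+1})}\right), $$ and $$ \sum_{\pi\in\mathcal{A}^s_n} t^{\mathrm{inv}(|\pi|)} \mathbf{x}^{\mathrm{Des}(\pi)} \mathbf{y}^{\mathrm{Neg}(\pi)}=\prod_{i=1}^{n}(1+t^{i-1}x_{i-1}y_{i}) +\sum_{j=1}^{n-1}\left( (x_{j}+t^{j-1}x_{j-1}y_{j})(t^{j(n-j)}+t^{n-j-1}y_{j+1})\prod_{i=1}^{j-1}(1+t^{i-1}x_{i-1}y_{i}) \prod_{i=j+2}^{n}(1+t^{n-i}x_{i-1}y_{i})\right). $$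
   Context: $B_n$ is the group of bijections $\pi$ of $\{\pm1,\dots,\pm n\}$ with $\pi(-a)=-\pi(a)$, written $\pi=[\pi(1),\dots,\pi(n)]$. An interval of $\mathbb{Z}_n$ is a set of the form $\{a,\dots,b\}$ or $\{b,\dots,n,1,\dots,a\}$ with $1\le a\le b\le n$. A permutation $\pi\in B_n$ is a signed arc permutation if for every $1<i<n$: (1) $\{|\pi(1)|,\dots,|\pi(i)|\}$ is an interval of $\mathbb{Z}_n$; and (2) $\pi(i)>0$ if $|\pi(i)|-1\in\{|\pi(1)|,\dots,|\pi(i-1)|\}$ and $\pi(i)<0$ if $|\pi(i)|+1\in\{|\pi(1)|,\dots,|\pi(i-1)|\}$, with arithmetic in $\mathbb{Z}_n$ (values in $\{1,\dots,n\}$); no restriction on the signs of $\pi(1),\pi(n)$. Descents in $B_n$ are taken with respect to the order $-1<-2<\cdots<-n<1<2<\cdots<n$: $\mathrm{Des}(\pi)=\{1\le i\le n-1:\pi(i)>\pi(i+1)\}$. $\mathrm{Neg}(\pi)=\{1\le i\le n:\pi(i)<0\}$. $|\pi|\in S_n$ is the permutation $|\pi(1)|\cdots|\pi(n)|$, and $\mathrm{inv}(\sigma)=\#\{i<j:\sigma(i)>\sigma(j)\}$. For a set $D=\{i_1,\dots,i_k\}$, $\mathbf{x}^D=x_{i_1}\cdots x_{i_k}$ and $\mathbf{y}^D=y_{i_1}\cdots y_{i_k}$. -}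

module Defs where

open import Data.Bool using (Bool; true; false; _∧_; _∨_; not; if_then_else_)
open import Data.Nat using (ℕ; zero; suc; _+_; _∸_; _≡ᵇ_; _<ᵇ_; _≤ᵇ_)
open import Data.Integer using (ℤ; +_; -[1+_]; ∣_∣)
open import Data.List using (List; []; _∷_; map; _++_; upTo; concatMap; length; foldr)
open import Data.Bool.ListAction using (any; all)
open import Algebra.Bundles using (CommutativeRing)

fromTo : ℕ → ℕ → List ℕ
fromTo a b = map (λ k → a + k) (upTo (suc b ∸ a))

bfilter : {A : Set} → (A → Bool) → List A → List A
bfilter p [] = []
bfilter p (a ∷ as) = if p a then a ∷ bfilter p as else bfilter p as

_==_ : Bool → Bool → Bool
true == b = b
false == b = not b

-- Signed permutations.  An element π of B_n is represented by its window
-- [π(1), ..., π(n)] : List ℤ.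

signedVals : ℕ → List ℤ
signedVals n = map -[1+_] (upTo n) ++ map (λ k → + suc k) (upTo n)

words : {A : Set} → ℕ → List A → List (List A)
words zero al = [] ∷ []
words (suc k) al = concatMap (λ a → map (a ∷_) (words k al)) al

-- π(i), 1-indexed (junk value 0 outside 1..length)
at : List ℤ → ℕ → ℤ
at [] i = + 0
at (a ∷ w) zero = + 0
at (a ∷ w) (suc zero) = a
at (a ∷ w) (suc (suc i)) = at w (suc i)

absAt : List ℤ → ℕ → ℕ
absAt π i = ∣ at π i ∣

isNegZ : ℤ → Bool
isNegZ (+ _) = false
isNegZ -[1+ _ ] = true

isPosZ : ℤ → Bool
isPosZ (+ zero) = false
isPosZ (+ suc _) = true
isPosZ -[1+ _ ] = false

-- window of length n, entries in {±1..±n}, absolute values pairwise distinct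
-- (equivalently: a bijection of {±1..±n} commuting with negation)
isSignedPerm : ℕ → List ℤ → Bool
isSignedPerm n π =
  (length π ≡ᵇ n)
  ∧ all (λ i → (1 ≤ᵇ absAt π i) ∧ (absAt π i ≤ᵇ n)) (fromTo 1 n)
  ∧ all (λ i → all (λ j → not (absAt π i ≡ᵇ absAt π j)) (fromTo (suc i) n)) (fromTo 1 n)

Bn : ℕ → List (List ℤ)
Bn n = bfilter (isSignedPerm n) (words n (signedVals n))

inPrefix : List ℤ → ℕ → ℕ → Bool
inPrefix π i m = any (λ k → absAt π k ≡ᵇ m) (fromTo 1 i)

-- S ⊆ {1..n} is an interval of ℤ_n: S = {a..b} or S = {b..n,1..a}, 1 ≤ a ≤ b ≤ n
isInterval : ℕ → (ℕ → Bool) → Bool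
isInterval n S =
  any (λ a → any (λ b →
        all (λ m → S m == ((a ≤ᵇ m) ∧ (m ≤ᵇ b))) (fromTo 1 n)
      ∨ all (λ m → S m == ((b ≤ᵇ m) ∨ (m ≤ᵇ a))) (fromTo 1 n))
    (fromTo a n)) (fromTo 1 n)

-- m+1 and m-1 in ℤ_n with representatives {1..n}
succZn : ℕ → ℕ → ℕ
succZn n m = if m ≡ᵇ n then 1 else suc m

predZn : ℕ → ℕ → ℕ
predZn n m = if m ≡ᵇ 1 then n else m ∸ 1

arcCond : ℕ → List ℤ → ℕ → Bool
arcCond n π i =
  isInterval n (inPrefix π i)
  ∧ (not (inPrefix π (i ∸ 1) (predZn n (absAt π i))) ∨ isPosZ (at π i))
  ∧ (not (inPrefix π (i ∸ 1) (succZn n (absAt π i))) ∨ isNegZ (at π i))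

isSignedArc : ℕ → List ℤ → Bool
isSignedArc n π = all (arcCond n π) (fromTo 2 (n ∸ 1))

SignedArc : ℕ → List (List ℤ)
SignedArc n = bfilter (isSignedArc n) (Bn n)

-- the order -1 < -2 < ... < -n < 1 < 2 < ... < n
_<B_ : ℤ → ℤ → Bool
-[1+ p ] <B -[1+ q ] = p <ᵇ q
-[1+ p ] <B (+ q) = true
(+ p) <B -[1+ q ] = false
(+ p) <B (+ q) = p <ᵇ q

Des : ℕ → List ℤ → List ℕ
Des n π = bfilter (λ i → at π (suc i) <B at π i) (fromTo 1 (n ∸ 1))

Neg : ℕ → List ℤ → List ℕ
Neg n π = bfilter (λ i → isNegZ (at π i)) (fromTo 1 n)

invAbs : ℕ → List ℤ → ℕ
invAbs n π = length (concatMap (λ i →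
  bfilter (λ j → absAt π j <ᵇ absAt π i) (fromTo (suc i) n)) (fromTo 1 n))

module RingOps {c ℓ} (R : CommutativeRing c ℓ) where
  open CommutativeRing R using (Carrier; 0#; 1#) renaming (_+_ to _+R_; _*_ to _*R_)

  sumL : {A : Set} → List A → (A → Carrier) → Carrier
  sumL l f = foldr (λ a r → f a +R r) 0# l

  prodL : {A : Set} → List A → (A → Carrier) → Carrier
  prodL l f = foldr (λ a r → f a *R r) 1# l

  sumR : ℕ → ℕ → (ℕ → Carrier) → Carrier
  sumR a b f = sumL (fromTo a b) f

  prodR : ℕ → ℕ → (ℕ → Carrier) → Carrier
  prodR a b f = prodL (fromTo a b) f

  pow : Carrier → ℕ → Carrier
  pow t zero = 1#
  pow t (suc k) = t *R pow t k

  mono : (ℕ → Carrier) → List ℕ → Carrier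
  mono x D = prodL D x

  withX0 : (ℕ → Carrier) → ℕ → Carrier
  withX0 x zero = 1#
  withX0 x (suc i) = x (suc i)

module Submission where

-- Read a window π(1)…π(n) letter by letter.  After i < n letters the set of absolute values
-- is a cyclic interval of ℤ_n, recorded with the sign of the last letter as a state `St`.
-- At a middle position exactly two letters keep the prefix valid: -λ and +ρ, where λ and ρ
-- are the cyclic left and right neighbours of the interval (the sign rule (2) forces the
-- signs, and any other value breaks the interval); at the last position the one missing
-- value may carry either sign.  Each admissible letter changes t^inv x^Des y^Neg by a factor
-- that depends on the state alone, so the sum over all completions of a valid prefix is
-- its weight times a transfer polynomial defined by a two-term recursion on states
-- (`TransferSum.extension-sum`).  Wrapped states evaluate to a product; segment states are
-- summed level by level, each level emitting one summand of identity (2)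
-- (`InversionFormula`).  Identity (1) is the case t = 1, after dividing by the factors
-- 1 + x_{j-1}y_j and 1 + x_j y_{j+1} through their given inverses u, v (`DescentFormula`).

open import Defs
open import Data.Nat using (ℕ; zero; suc; _∸_; _≤_) renaming (_+_ to _+ℕ_; _*_ to _*ℕ_)
open import Data.Product using (_×_; _,_)
open import Algebra.Bundles using (CommutativeRing)
import Relation.Binary.PropositionalEquality as P

module Combinatorics where

  open import Data.Bool using (Bool; true; false; _∧_; _∨_; not; if_then_else_; T)
  open import Data.Bool.Properties using (∧-zeroʳ; ∨-zeroʳ; ∨-identityʳ; not-¬; T-≡)
  import Data.Bool.Properties
  open import Data.Nat using (_+_; _<_; _≡ᵇ_; _<ᵇ_; _≤ᵇ_; z≤n; s≤s; s≤s⁻¹)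
  open import Data.Nat.Properties
  open import Data.Integer using (ℤ; -[1+_]; ∣_∣) renaming (+_ to pos)
  open import Data.List using (List; []; _∷_; map; _++_; upTo; concatMap; length; applyUpTo)
  open import Data.List.Properties using (length-++)
  import Data.List.Properties
  open import Data.List.Membership.Propositional using (_∈_)
  open import Data.List.Relation.Unary.Any using (here; there)
  open import Data.Bool.ListAction using (any; all)
  open import Data.Product using (Σ; proj₁; proj₂)
  open import Data.Sum using (_⊎_; inj₁; inj₂)
  open import Data.Empty using (⊥; ⊥-elim)
  open import Data.Unit using (⊤; tt)
  open import Function.Bundles using (Equivalence)
  open import Relation.Binary.PropositionalEquality
  open import Relation.Nullary using (yes; no)

  module Ranges where

    -- Boolean reflection of the decidable comparisons on ℕ and of ∧/∨, stated as
    -- equations `b ≡ true` / `b ≡ false` so that they can be used with `rewrite`.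
    T⇒≡true : ∀ {b} → T b → b ≡ true
    T⇒≡true = Equivalence.to T-≡

    ≡true⇒T : ∀ {b} → b ≡ true → T b
    ≡true⇒T = Equivalence.from T-≡

    ≤ᵇ-t : ∀ {m n} → m ≤ n → (m ≤ᵇ n) ≡ true
    ≤ᵇ-t p = T⇒≡true (≤⇒≤ᵇ p)

    ≤ᵇ-f : ∀ {m n} → n < m → (m ≤ᵇ n) ≡ false
    ≤ᵇ-f {m} {n} p with m ≤ᵇ n in eq
    ... | false = refl
    ... | true = ⊥-elim (<⇒≱ p (≤ᵇ⇒≤ m n (≡true⇒T eq)))

    <ᵇ-t : ∀ {m n} → m < n → (m <ᵇ n) ≡ true
    <ᵇ-t p = T⇒≡true (<⇒<ᵇ p)

    <ᵇ-f : ∀ {m n} → n ≤ m → (m <ᵇ n) ≡ false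
    <ᵇ-f {m} {n} p with m <ᵇ n in eq
    ... | false = refl
    ... | true = ⊥-elim (≤⇒≯ p (<ᵇ⇒< m n (≡true⇒T eq)))

    ≡ᵇ-t : ∀ {m n} → m ≡ n → (m ≡ᵇ n) ≡ true
    ≡ᵇ-t {m} {n} p = T⇒≡true (≡⇒≡ᵇ m n p)

    ≡ᵇ-f : ∀ {m n} → m ≢ n → (m ≡ᵇ n) ≡ false
    ≡ᵇ-f {m} {n} p with m ≡ᵇ n in eq
    ... | false = refl
    ... | true = ⊥-elim (p (≡ᵇ⇒≡ m n (≡true⇒T eq)))

    ≡ᵇ-sound : ∀ {m n} → (m ≡ᵇ n) ≡ true → m ≡ n
    ≡ᵇ-sound {m} {n} e = ≡ᵇ⇒≡ m n (≡true⇒T e)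

    ≤ᵇ-sound : ∀ {m n} → (m ≤ᵇ n) ≡ true → m ≤ n
    ≤ᵇ-sound {m} {n} e = ≤ᵇ⇒≤ m n (≡true⇒T e)

    ≤ᵇ-false-sound : ∀ {m n} → (m ≤ᵇ n) ≡ false → n < m
    ≤ᵇ-false-sound {m} {n} e with m ≤? n
    ... | yes p with () ← trans (sym (≤ᵇ-t p)) e
    ... | no np = ≰⇒> np

    ∧-true : ∀ {a b} → a ≡ true → b ≡ true → (a ∧ b) ≡ true
    ∧-true refl refl = refl

    ∨-introˡ : ∀ {a} b → a ≡ true → (a ∨ b) ≡ true
    ∨-introˡ b refl = refl

    ∨-introʳ : ∀ a {b} → b ≡ true → (a ∨ b) ≡ true
    ∨-introʳ true refl = refl
    ∨-introʳ false refl = refl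

    ∧-elimˡ : ∀ {a b} → (a ∧ b) ≡ true → a ≡ true
    ∧-elimˡ {true} _ = refl

    ∧-elimʳ : ∀ {a b} → (a ∧ b) ≡ true → b ≡ true
    ∧-elimʳ {true} e = e

    bool-ext : ∀ {b c} → (b ≡ true → c ≡ true) → (c ≡ true → b ≡ true) → b ≡ c
    bool-ext {true} {true} f g = refl
    bool-ext {true} {false} f g = sym (f refl)
    bool-ext {false} {true} f g = g refl
    bool-ext {false} {false} f g = refl

    ∨-elim : ∀ {a b} → (a ∨ b) ≡ true → (a ≡ true) ⊎ (b ≡ true)
    ∨-elim {true} e = inj₁ refl
    ∨-elim {false} e = inj₂ e

    false≢true : ∀ {b} → b ≡ false → b ≡ true → ⊥
    false≢true refl ()

    -- `rng a k` is the list a, a+1, …, a+k-1; `fromTo a b` (from Defs) is `rng a (b+1-a)`,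
    -- which gives it the expected cons/snoc/membership behaviour.
    rng : ℕ → ℕ → List ℕ
    rng a zero = []
    rng a (suc k) = a ∷ rng (suc a) k

    applyUpTo-cong : ∀ (f g : ℕ → ℕ) k → (∀ i → f i ≡ g i) → applyUpTo f k ≡ applyUpTo g k
    applyUpTo-cong f g zero e = refl
    applyUpTo-cong f g (suc k) e = cong₂ _∷_ (e 0) (applyUpTo-cong (λ i → f (suc i)) (λ i → g (suc i)) k (λ i → e (suc i)))

    applyUpTo-rng : ∀ a k → applyUpTo (λ i → a + i) k ≡ rng a k
    applyUpTo-rng a zero = refl
    applyUpTo-rng a (suc k) = cong₂ _∷_ (+-identityʳ a)
      (trans (applyUpTo-cong (λ i → a + suc i) (λ i → suc a + i) k (λ i → +-suc a i)) (applyUpTo-rng (suc a) k))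

    fromTo-rng : ∀ a b → fromTo a b ≡ rng a (suc b ∸ a)
    fromTo-rng a b = trans (Data.List.Properties.map-upTo (λ k → a + k) (suc b ∸ a)) (applyUpTo-rng a (suc b ∸ a))

    rng-snoc : ∀ a k → rng a (suc k) ≡ rng a k ++ (a + k) ∷ []
    rng-snoc a zero = cong (_∷ []) (sym (+-identityʳ a))
    rng-snoc a (suc k) = cong (a ∷_) (trans (rng-snoc (suc a) k) (cong (λ z → rng (suc a) k ++ z ∷ []) (sym (+-suc a k))))

    fromTo-nil : ∀ a b → b < a → fromTo a b ≡ []
    fromTo-nil a b p rewrite fromTo-rng a b | m≤n⇒m∸n≡0 p = refl

    fromTo-cons : ∀ a b → a ≤ b → fromTo a b ≡ a ∷ fromTo (suc a) b
    fromTo-cons a b p rewrite fromTo-rng a b | fromTo-rng (suc a) b | +-∸-assoc 1 p = refl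

    fromTo-snoc : ∀ a b → a ≤ suc b → fromTo a (suc b) ≡ fromTo a b ++ suc b ∷ []
    fromTo-snoc a b p rewrite fromTo-rng a (suc b) | fromTo-rng a b | +-∸-assoc 1 p
      = trans (rng-snoc a (suc b ∸ a)) (cong (λ z → rng a (suc b ∸ a) ++ z ∷ []) (m+[n∸m]≡n p))

    rng-∈ : ∀ a k i → a ≤ i → i < a + k → i ∈ rng a k
    rng-∈ a zero i p q = ⊥-elim (<⇒≱ q (subst (_≤ i) (sym (+-identityʳ a)) p))
    rng-∈ a (suc k) i p q with m≤n⇒m<n∨m≡n p
    ... | inj₂ refl = here refl
    ... | inj₁ a<i = there (rng-∈ (suc a) k i a<i (subst (i <_) (+-suc a k) q))

    rng-∈⁻ : ∀ a k i → i ∈ rng a k → (a ≤ i) × (i < a + k)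
    rng-∈⁻ a (suc k) .a (here refl) = ≤-refl , subst (a <_) (sym (+-suc a k)) (s≤s (m≤m+n a k))
    rng-∈⁻ a (suc k) i (there m) with rng-∈⁻ (suc a) k i m
    ... | p , q = <⇒≤ p , subst (i <_) (sym (+-suc a k)) q

    fromTo-∈ : ∀ {a b i} → a ≤ i → i ≤ b → i ∈ fromTo a b
    fromTo-∈ {a} {b} {i} p q rewrite fromTo-rng a b =
      rng-∈ a (suc b ∸ a) i p (subst (i <_) (sym (m+[n∸m]≡n (≤-trans p (m≤n⇒m≤1+n q)))) (s≤s q))

    fromTo-∈⁻ : ∀ {a b i} → i ∈ fromTo a b → (a ≤ i) × (i ≤ b)
    fromTo-∈⁻ {a} {b} {i} m rewrite fromTo-rng a b with rng-∈⁻ a (suc b ∸ a) i m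
    ... | p , q with a ≤? suc b
    ...   | yes a≤ = p , s≤s⁻¹ (subst (i <_) (m+[n∸m]≡n a≤) q)
    ...   | no a≰ = ⊥-elim (<⇒≱ (subst (i <_) (trans (cong (a +_) (m≤n⇒m∸n≡0 (<⇒≤ (≰⇒> a≰)))) (+-identityʳ a)) q) p)

    module _ (p : ℕ → Bool) where
      all-∈-true : ∀ l → (∀ i → i ∈ l → p i ≡ true) → all p l ≡ true
      all-∈-true [] h = refl
      all-∈-true (x ∷ l) h = ∧-true (h x (here refl)) (all-∈-true l (λ i m → h i (there m)))

      all-∈-false : ∀ l {i} → i ∈ l → p i ≡ false → all p l ≡ false
      all-∈-false (x ∷ l) (here refl) e rewrite e = refl
      all-∈-false (x ∷ l) (there m) e rewrite all-∈-false l m e = ∧-zeroʳ (p x)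

      any-∈-true : ∀ l {i} → i ∈ l → p i ≡ true → any p l ≡ true
      any-∈-true (x ∷ l) (here refl) e rewrite e = refl
      any-∈-true (x ∷ l) (there m) e rewrite any-∈-true l m e = ∨-zeroʳ (p x)

      any-∈-false : ∀ l → (∀ i → i ∈ l → p i ≡ false) → any p l ≡ false
      any-∈-false [] h = refl
      any-∈-false (x ∷ l) h rewrite h x (here refl) = any-∈-false l (λ i m → h i (there m))

      any-∈-elim : ∀ l → any p l ≡ true → Σ ℕ (λ i → (i ∈ l) × (p i ≡ true))
      any-∈-elim (x ∷ l) e with p x in eq
      ... | true = x , (here refl) , eq
      ... | false with any-∈-elim l e
      ...   | i , m , q = i , there m , q

    module _ {p q : ℕ → Bool} where
      all-cong : ∀ l → (∀ i → i ∈ l → p i ≡ q i) → all p l ≡ all q l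
      all-cong [] h = refl
      all-cong (x ∷ l) h = cong₂ _∧_ (h x (here refl)) (all-cong l (λ i m → h i (there m)))

      any-cong : ∀ l → (∀ i → i ∈ l → p i ≡ q i) → any p l ≡ any q l
      any-cong [] h = refl
      any-cong (x ∷ l) h = cong₂ _∨_ (h x (here refl)) (any-cong l (λ i m → h i (there m)))

      bfilter-cong : ∀ l → (∀ i → i ∈ l → p i ≡ q i) → bfilter p l ≡ bfilter q l
      bfilter-cong [] h = refl
      bfilter-cong (x ∷ l) h rewrite h x (here refl) with q x
      ... | true = cong (x ∷_) (bfilter-cong l (λ i m → h i (there m)))
      ... | false = bfilter-cong l (λ i m → h i (there m))

    bfilter-++ : ∀ {A : Set} (p : A → Bool) l l' → bfilter p (l ++ l') ≡ bfilter p l ++ bfilter p l'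
    bfilter-++ p [] l' = refl
    bfilter-++ p (x ∷ l) l' with p x
    ... | true = cong (x ∷_) (bfilter-++ p l l')
    ... | false = bfilter-++ p l l'

    any-++ : ∀ (p : ℕ → Bool) l l' → any p (l ++ l') ≡ (any p l ∨ any p l')
    any-++ p [] l' = refl
    any-++ p (x ∷ l) l' rewrite any-++ p l l' = sym (Data.Bool.Properties.∨-assoc (p x) (any p l) (any p l'))

    nsum : List ℕ → (ℕ → ℕ) → ℕ
    nsum [] f = 0
    nsum (x ∷ l) f = f x + nsum l f

    nsum-++ : ∀ l l' f → nsum (l ++ l') f ≡ nsum l f + nsum l' f
    nsum-++ [] l' f = refl
    nsum-++ (x ∷ l) l' f rewrite nsum-++ l l' f = sym (+-assoc (f x) (nsum l f) (nsum l' f))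

    nsum-cong : ∀ l {f g} → (∀ i → i ∈ l → f i ≡ g i) → nsum l f ≡ nsum l g
    nsum-cong [] h = refl
    nsum-cong (x ∷ l) h = cong₂ _+_ (h x (here refl)) (nsum-cong l (λ i m → h i (there m)))

    ind : Bool → ℕ
    ind true = 1
    ind false = 0

    length-bfilter : ∀ (p : ℕ → Bool) l → length (bfilter p l) ≡ nsum l (λ i → ind (p i))
    length-bfilter p [] = refl
    length-bfilter p (x ∷ l) with p x
    ... | true = cong suc (length-bfilter p l)
    ... | false = length-bfilter p l

    nsum-all1 : ∀ l (p : ℕ → Bool) → (∀ i → i ∈ l → p i ≡ true) → nsum l (λ i → ind (p i)) ≡ length l
    nsum-all1 [] p h = refl
    nsum-all1 (x ∷ l) p h rewrite h x (here refl) = cong suc (nsum-all1 l p (λ i m → h i (there m)))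

    nsum-all0 : ∀ l (p : ℕ → Bool) → (∀ i → i ∈ l → p i ≡ false) → nsum l (λ i → ind (p i)) ≡ 0
    nsum-all0 [] p h = refl
    nsum-all0 (x ∷ l) p h rewrite h x (here refl) = nsum-all0 l p (λ i m → h i (there m))

    length-fromTo1 : ∀ s → length (fromTo 1 s) ≡ s
    length-fromTo1 s = trans (Data.List.Properties.length-map (1 +_) (upTo s)) (Data.List.Properties.length-upTo s)

    length-concatMap : ∀ (f : ℕ → List ℕ) l → length (concatMap f l) ≡ nsum l (λ i → length (f i))
    length-concatMap f [] = refl
    length-concatMap f (x ∷ l) = trans (length-++ (f x)) (cong (length (f x) +_) (length-concatMap f l))

  module Windows where

    open Ranges

    -- The letter -m (junk value 0 for m = 0); `pos m` is the letter +m.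
    neg : ℕ → ℤ
    neg zero = pos 0
    neg (suc k) = -[1+ k ]

    at-++ : ∀ (p w : List ℤ) i → 1 ≤ i → i ≤ length p → at (p ++ w) i ≡ at p i
    at-++ (b ∷ p) w (suc zero) _ _ = refl
    at-++ (b ∷ p) w (suc (suc i)) _ (s≤s q) = at-++ p w (suc i) (s≤s z≤n) q

    at-snoc : ∀ (p : List ℤ) a w → at (p ++ a ∷ w) (suc (length p)) ≡ a
    at-snoc [] a w = refl
    at-snoc (b ∷ []) a w = refl
    at-snoc (b ∷ c ∷ p) a w = at-snoc (c ∷ p) a w

    absAt-++ : ∀ (p w : List ℤ) i → 1 ≤ i → i ≤ length p → absAt (p ++ w) i ≡ absAt p i
    absAt-++ p w i h1 h2 = cong ∣_∣ (at-++ p w i h1 h2)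

    inPrefix-++ : ∀ (p w : List ℤ) i m → i ≤ length p → inPrefix (p ++ w) i m ≡ inPrefix p i m
    inPrefix-++ p w i m h = any-cong (fromTo 1 i) (λ k mem →
      let (a , b) = fromTo-∈⁻ mem in cong (_≡ᵇ m) (absAt-++ p w k a (≤-trans b h)))

    inPrefix-snoc : ∀ (p : List ℤ) a w m →
      inPrefix (p ++ a ∷ w) (suc (length p)) m ≡ (inPrefix p (length p) m ∨ (∣ a ∣ ≡ᵇ m))
    inPrefix-snoc p a w m =
      trans (cong (any (λ k → absAt (p ++ a ∷ w) k ≡ᵇ m)) (fromTo-snoc 1 (length p) (s≤s z≤n)))
      (trans (any-++ (λ k → absAt (p ++ a ∷ w) k ≡ᵇ m) (fromTo 1 (length p)) (suc (length p) ∷ []))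
      (cong₂ _∨_ (inPrefix-++ p (a ∷ w) (length p) m ≤-refl)
         (trans (∨-identityʳ _) (cong (λ z → ∣ z ∣ ≡ᵇ m) (at-snoc p a w)))))

    inPrefix-true : ∀ (p : List ℤ) i k → 1 ≤ k → k ≤ i → inPrefix p i (absAt p k) ≡ true
    inPrefix-true p i k h1 h2 = any-∈-true (λ j → absAt p j ≡ᵇ absAt p k) (fromTo 1 i) (fromTo-∈ h1 h2) (≡ᵇ-t {absAt p k} refl)

    inPrefix-elim : ∀ (p : List ℤ) i m → inPrefix p i m ≡ true → Σ ℕ (λ k → (1 ≤ k) × (k ≤ i) × (absAt p k ≡ m))
    inPrefix-elim p i m e with any-∈-elim (λ j → absAt p j ≡ᵇ m) (fromTo 1 i) e
    ... | k , mem , q = k , proj₁ (fromTo-∈⁻ mem) , proj₂ (fromTo-∈⁻ mem) , ≡ᵇ-sound q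

    ==-refl : ∀ b → (b == b) ≡ true
    ==-refl true = refl
    ==-refl false = refl

    ==-false : ∀ {b c} → b ≢ c → (b == c) ≡ false
    ==-false {true} {true} h = ⊥-elim (h refl)
    ==-false {true} {false} h = refl
    ==-false {false} {true} h = refl
    ==-false {false} {false} h = ⊥-elim (h refl)

    isInterval-cong : ∀ n (S S' : ℕ → Bool) → (∀ m → 1 ≤ m → m ≤ n → S m ≡ S' m) → isInterval n S ≡ isInterval n S'
    isInterval-cong n S S' h = any-cong (fromTo 1 n) (λ a _ → any-cong (fromTo a n) (λ b _ →
      cong₂ _∨_ (all-cong (fromTo 1 n) (λ m mem → cong (_== _) (h m (proj₁ (fromTo-∈⁻ mem)) (proj₂ (fromTo-∈⁻ mem)))))
                (all-cong (fromTo 1 n) (λ m mem → cong (_== _) (h m (proj₁ (fromTo-∈⁻ mem)) (proj₂ (fromTo-∈⁻ mem)))))))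

    all-agree : ∀ n (S F : ℕ → Bool) → (∀ m → S m ≡ F m) → all (λ m → S m == F m) (fromTo 1 n) ≡ true
    all-agree n S F h = all-∈-true (λ m → S m == F m) (fromTo 1 n) (λ m _ → trans (cong (_== F m) (h m)) (==-refl (F m)))

    isInterval-witness : ∀ n (S : ℕ → Bool) a b → 1 ≤ a → a ≤ b → b ≤ n →
      (all (λ m → S m == ((a ≤ᵇ m) ∧ (m ≤ᵇ b))) (fromTo 1 n) ∨ all (λ m → S m == ((b ≤ᵇ m) ∨ (m ≤ᵇ a))) (fromTo 1 n)) ≡ true →
      isInterval n S ≡ true
    isInterval-witness n S a b h1 h2 h3 w =
      any-∈-true (λ a' → any (λ b' → all (λ m → S m == ((a' ≤ᵇ m) ∧ (m ≤ᵇ b'))) (fromTo 1 n)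
                                     ∨ all (λ m → S m == ((b' ≤ᵇ m) ∨ (m ≤ᵇ a'))) (fromTo 1 n)) (fromTo a' n))
        (fromTo 1 n) (fromTo-∈ h1 (≤-trans h2 h3))
        (any-∈-true (λ b' → all (λ m → S m == ((a ≤ᵇ m) ∧ (m ≤ᵇ b'))) (fromTo 1 n)
                            ∨ all (λ m → S m == ((b' ≤ᵇ m) ∨ (m ≤ᵇ a))) (fromTo 1 n)) (fromTo a n) (fromTo-∈ h2 h3) w)

    isInterval-segment : ∀ n (S : ℕ → Bool) a b → 1 ≤ a → a ≤ b → b ≤ n →
      (∀ m → S m ≡ ((a ≤ᵇ m) ∧ (m ≤ᵇ b))) → isInterval n S ≡ true
    isInterval-segment n S a b h1 h2 h3 h = isInterval-witness n S a b h1 h2 h3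
      (∨-introˡ (all (λ m → S m == ((b ≤ᵇ m) ∨ (m ≤ᵇ a))) (fromTo 1 n)) (all-agree n S _ h))

    isInterval-wrapped : ∀ n (S : ℕ → Bool) a b → 1 ≤ a → a ≤ b → b ≤ n →
      (∀ m → S m ≡ ((b ≤ᵇ m) ∨ (m ≤ᵇ a))) → isInterval n S ≡ true
    isInterval-wrapped n S a b h1 h2 h3 h = isInterval-witness n S a b h1 h2 h3
      (∨-introʳ (all (λ m → S m == ((a ≤ᵇ m) ∧ (m ≤ᵇ b))) (fromTo 1 n)) (all-agree n S _ h))

    segment-convex : ∀ a b i j k → ((a ≤ᵇ i) ∧ (i ≤ᵇ b)) ≡ true → ((a ≤ᵇ k) ∧ (k ≤ᵇ b)) ≡ true → i ≤ j → j ≤ k →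
      ((a ≤ᵇ j) ∧ (j ≤ᵇ b)) ≡ true
    segment-convex a b i j k e1 e2 p q =
      ∧-true (≤ᵇ-t {a} {j} (≤-trans (≤ᵇ-sound {a} {i} (∧-elimˡ {a ≤ᵇ i} {i ≤ᵇ b} e1)) p))
             (≤ᵇ-t {j} {b} (≤-trans q (≤ᵇ-sound {k} {b} (∧-elimʳ {a ≤ᵇ k} e2))))

    ∨-false-l : ∀ {a b} → (a ∨ b) ≡ false → a ≡ false
    ∨-false-l {false} _ = refl

    ∨-false-r : ∀ {a b} → (a ∨ b) ≡ false → b ≡ false
    ∨-false-r {false} e = e

    ∨-false : ∀ {a b} → a ≡ false → b ≡ false → (a ∨ b) ≡ false
    ∨-false refl refl = refl

    wrapped-gap-convex : ∀ a b i j k → ((b ≤ᵇ i) ∨ (i ≤ᵇ a)) ≡ false → ((b ≤ᵇ k) ∨ (k ≤ᵇ a)) ≡ false → i ≤ j → j ≤ k →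
      ((b ≤ᵇ j) ∨ (j ≤ᵇ a)) ≡ false
    wrapped-gap-convex a b i j k e1 e2 p q =
      ∨-false (≤ᵇ-f {b} {j} (≤-<-trans q (≤ᵇ-false-sound {b} {k} (∨-false-l {b ≤ᵇ k} e2))))
              (≤ᵇ-f {j} {a} (<-≤-trans (≤ᵇ-false-sound {i} {a} (∨-false-r {b ≤ᵇ i} e1)) p))

    three-point-mismatch : ∀ (S F : ℕ → Bool) β i j k → (F i ≡ β → F k ≡ β → F j ≡ β) →
      S i ≡ β → S j ≡ not β → S k ≡ β →
      ((S i == F i) ≡ false) ⊎ ((S j == F j) ≡ false) ⊎ ((S k == F k) ≡ false)
    three-point-mismatch S F β i j k cv si sj sk with Data.Bool.Properties._≟_ (F i) β | Data.Bool.Properties._≟_ (F k) β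
    ... | yes fi | yes fk = inj₂ (inj₁ (==-false (λ e → not-¬ refl (trans (sym (cv fi fk)) (trans (sym e) sj)))))
    ... | no fi | _ = inj₁ (==-false (λ e → fi (trans (sym e) si)))
    ... | yes _ | no fk = inj₂ (inj₂ (==-false (λ e → fk (trans (sym e) sk))))

    all-agree-fails : ∀ n (S F : ℕ → Bool) m → 1 ≤ m → m ≤ n → (S m == F m) ≡ false →
      all (λ z → S z == F z) (fromTo 1 n) ≡ false
    all-agree-fails n S F m h1 h2 e = all-∈-false (λ z → S z == F z) (fromTo 1 n) (fromTo-∈ h1 h2) e

    -- A set whose indicator alternates σ, not σ, σ, not σ at four increasing points of {1..n}
    -- is not a (possibly wrapped) interval: every candidate segment and every candidate
    -- wrapped set is refuted by three consecutive of the four points.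
    alternating-not-interval : ∀ n (S : ℕ → Bool) σ x1 x2 x3 x4 → 1 ≤ x1 → x1 < x2 → x2 < x3 → x3 < x4 → x4 ≤ n →
      S x1 ≡ σ → S x2 ≡ not σ → S x3 ≡ σ → S x4 ≡ not σ → isInterval n S ≡ false
    alternating-not-interval n S σ x1 x2 x3 x4 h1 h12 h23 h34 h4 s1 s2 s3 s4 =
      any-∈-false _ (fromTo 1 n) (λ a _ → any-∈-false _ (fromTo a n) (λ b _ →
        ∨-false (not-segment σ s1 s2 s3 s4 a b) (not-wrapped σ s1 s2 s3 s4 a b)))
      where
      b1 = h1
      b2 = ≤-trans h1 (<⇒≤ h12)
      b3 = ≤-trans b2 (<⇒≤ h23)
      b4 = ≤-trans b3 (<⇒≤ h34)
      c3 = ≤-trans (<⇒≤ h34) h4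
      c2 = ≤-trans (<⇒≤ h23) c3
      c1 = ≤-trans (<⇒≤ h12) c2
      pick : ∀ (F : ℕ → Bool) {i j k} → 1 ≤ i → i ≤ n → 1 ≤ j → j ≤ n → 1 ≤ k → k ≤ n →
        ((S i == F i) ≡ false) ⊎ ((S j == F j) ≡ false) ⊎ ((S k == F k) ≡ false) →
        all (λ z → S z == F z) (fromTo 1 n) ≡ false
      pick F {i} a1 a2 _ _ _ _ (inj₁ e) = all-agree-fails n S F i a1 a2 e
      pick F {j = j} _ _ a1 a2 _ _ (inj₂ (inj₁ e)) = all-agree-fails n S F j a1 a2 e
      pick F {k = k} _ _ _ _ a1 a2 (inj₂ (inj₂ e)) = all-agree-fails n S F k a1 a2 e
      not-segment : ∀ σ → S x1 ≡ σ → S x2 ≡ not σ → S x3 ≡ σ → S x4 ≡ not σ → ∀ a b →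
        all (λ m → S m == ((a ≤ᵇ m) ∧ (m ≤ᵇ b))) (fromTo 1 n) ≡ false
      not-segment true s1 s2 s3 s4 a b = pick F b1 c1 b2 c2 b3 c3
        (three-point-mismatch S F true x1 x2 x3 (λ e1 e2 → segment-convex a b x1 x2 x3 e1 e2 (<⇒≤ h12) (<⇒≤ h23)) s1 s2 s3)
        where F = λ m → (a ≤ᵇ m) ∧ (m ≤ᵇ b)
      not-segment false s1 s2 s3 s4 a b = pick F b2 c2 b3 c3 b4 h4
        (three-point-mismatch S F true x2 x3 x4 (λ e1 e2 → segment-convex a b x2 x3 x4 e1 e2 (<⇒≤ h23) (<⇒≤ h34)) s2 s3 s4)
        where F = λ m → (a ≤ᵇ m) ∧ (m ≤ᵇ b)
      not-wrapped : ∀ σ → S x1 ≡ σ → S x2 ≡ not σ → S x3 ≡ σ → S x4 ≡ not σ → ∀ a b →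
        all (λ m → S m == ((b ≤ᵇ m) ∨ (m ≤ᵇ a))) (fromTo 1 n) ≡ false
      not-wrapped false s1 s2 s3 s4 a b = pick F b1 c1 b2 c2 b3 c3
        (three-point-mismatch S F false x1 x2 x3 (λ e1 e2 → wrapped-gap-convex a b x1 x2 x3 e1 e2 (<⇒≤ h12) (<⇒≤ h23)) s1 s2 s3)
        where F = λ m → (b ≤ᵇ m) ∨ (m ≤ᵇ a)
      not-wrapped true s1 s2 s3 s4 a b = pick F b2 c2 b3 c3 b4 h4
        (three-point-mismatch S F false x2 x3 x4 (λ e1 e2 → wrapped-gap-convex a b x2 x3 x4 e1 e2 (<⇒≤ h23) (<⇒≤ h34)) s2 s3 s4)
        where F = λ m → (b ≤ᵇ m) ∨ (m ≤ᵇ a)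

  module States (n : ℕ) where

    open Ranges
    open Windows

    -- After s letters the
    -- set of absolute values is `seg l s d` = {l+1, …, l+s} or `wrap a u d` = {1..a} ∪ {n-u+1..n}
    -- (a, u ≥ 1, a + u < n); the flag d records whether the last letter was positive.
    data St : Set where
      seg : ℕ → ℕ → Bool → St
      wrap : ℕ → ℕ → Bool → St

    size : St → ℕ
    size (seg l s d) = s
    size (wrap a u d) = a + u

    WellFormed : St → Set
    WellFormed (seg l s d) = (1 ≤ s) × (l + s ≤ n)
    WellFormed (wrap a u d) = (1 ≤ a) × (1 ≤ u) × (a + u < n)

    size≥1 : ∀ st → WellFormed st → 1 ≤ size st
    size≥1 (seg l s d) (s1 , _) = s1
    size≥1 (wrap a u d) (a1 , _) = ≤-trans a1 (m≤m+n a u)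

    members : St → ℕ → Bool
    members (seg l s d) m = (suc l ≤ᵇ m) ∧ (m ≤ᵇ l + s)
    members (wrap a u d) m = (suc (n ∸ u) ≤ᵇ m) ∨ (m ≤ᵇ a)

    -- The cyclic left neighbour λ and right neighbour ρ of the interval: the only values
    -- that can be appended before the last position.
    leftNbr : St → ℕ
    leftNbr (seg zero s d) = n
    leftNbr (seg (suc l) s d) = suc l
    leftNbr (wrap a u d) = n ∸ u

    rightNbr : St → ℕ
    rightNbr (seg l s d) = if l + s ≡ᵇ n then 1 else suc (l + s)
    rightNbr (wrap a u d) = suc a

    -- The last letter read: at the right end if positive, at the left end if negative.
    lastLetter : St → ℤ
    lastLetter (seg l s true) = pos (l + s)
    lastLetter (seg l s false) = neg (suc l)
    lastLetter (wrap a u true) = pos a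
    lastLetter (wrap a u false) = neg (suc (n ∸ u))

    -- The states after appending -λ and +ρ respectively.
    growLeft : St → St
    growLeft (seg zero s d) = wrap s 1 false
    growLeft (seg (suc l) s d) = seg l (suc s) false
    growLeft (wrap a u d) = wrap a (suc u) false

    growRight : St → St
    growRight (seg l s d) = if l + s ≡ᵇ n then wrap 1 s true else seg l (suc s) true
    growRight (wrap a u d) = wrap (suc a) u true

    -- Number of earlier values exceeding λ (resp. ρ): the new inversions of |π|.
    invLeft : St → ℕ
    invLeft (seg zero s d) = 0
    invLeft (seg (suc l) s d) = s
    invLeft (wrap a u d) = u

    invRight : St → ℕ
    invRight (seg l s d) = if l + s ≡ᵇ n then s else 0
    invRight (wrap a u d) = u

    desLeft : St → Bool
    desLeft (seg zero s d) = d
    desLeft (seg (suc l) s d) = true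
    desLeft (wrap a u d) = true

    desRight : St → Bool
    desRight (seg l s d) = if l + s ≡ᵇ n then d else false
    desRight (wrap a u d) = false

    aboveLeft : St → ℕ → Bool
    aboveLeft (seg zero s d) m = false
    aboveLeft (seg (suc l) s d) m = true
    aboveLeft (wrap a u d) m = n ∸ u <ᵇ m

    aboveRight : St → ℕ → Bool
    aboveRight (seg l s d) m = l + s ≡ᵇ n
    aboveRight (wrap a u d) m = n ∸ u <ᵇ m

    wrap-gap : ∀ {a u} → a + u < n → Σ ℕ (λ c → (n ∸ u ≡ c) × (c + u ≡ n) × (a < c))
    wrap-gap {a} {u} h = n ∸ u , refl , m∸n+n≡m (≤-trans (m≤n+m u a) (<⇒≤ h)) ,
      m+n≤o⇒m≤o∸n (suc a) h

    leftNbr-range : ∀ st → WellFormed st → size st < n → (1 ≤ leftNbr st) × (leftNbr st ≤ n)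
    leftNbr-range (seg zero s d) (s1 , _) lt = ≤-trans s1 (<⇒≤ lt) , ≤-refl
    leftNbr-range (seg (suc l) s d) (s1 , ls) lt = s≤s z≤n , ≤-trans (m≤m+n (suc l) s) ls
    leftNbr-range (wrap a u d) (a1 , u1 , h) lt with wrap-gap {a} {u} h
    ... | c , e , e2 , ac rewrite e = ≤-trans a1 (<⇒≤ ac) , subst (_≤ n) e (m∸n≤m n u)

    rightNbr-range : ∀ st → WellFormed st → size st < n → (1 ≤ rightNbr st) × (rightNbr st ≤ n)
    rightNbr-range (seg l s d) (s1 , ls) lt with l + s ≟ n
    ... | yes e rewrite ≡ᵇ-t e = ≤-refl , ≤-trans s1 (<⇒≤ lt)
    ... | no ne rewrite ≡ᵇ-f ne = s≤s z≤n , ≤∧≢⇒< ls ne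
    rightNbr-range (wrap a u d) (a1 , u1 , h) lt = s≤s z≤n , ≤-trans (s≤s (m≤m+n a u)) h

    leftNbr-fresh : ∀ st → WellFormed st → size st < n → members st (leftNbr st) ≡ false
    leftNbr-fresh (seg zero s d) (s1 , _) lt = ∧-zeroʳ' (≤ᵇ-f lt)
      where ∧-zeroʳ' : ∀ {a b} → b ≡ false → (a ∧ b) ≡ false
            ∧-zeroʳ' {a} refl = ∧-zeroʳ a
    leftNbr-fresh (seg (suc l) s d) _ _ rewrite ≤ᵇ-f {suc (suc l)} {suc l} ≤-refl = refl
    leftNbr-fresh (wrap a u d) (a1 , u1 , h) lt with wrap-gap {a} {u} h
    ... | c , e , e2 , ac rewrite e | ≤ᵇ-f {suc c} {c} ≤-refl | ≤ᵇ-f {c} {a} ac = refl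

    offset-positive : ∀ l s → s < n → l + s ≡ n → 1 ≤ l
    offset-positive zero s lt e = ⊥-elim (<⇒≢ lt e)
    offset-positive (suc l) s lt e = s≤s z≤n

    rightNbr-fresh : ∀ st → WellFormed st → size st < n → members st (rightNbr st) ≡ false
    rightNbr-fresh (seg l s d) (s1 , ls) lt with l + s ≟ n
    ... | yes e rewrite ≡ᵇ-t e | ≤ᵇ-f {suc l} {1} (s≤s (offset-positive l s lt e)) = refl
    ... | no ne rewrite ≡ᵇ-f ne | ≤ᵇ-f {suc (l + s)} {l + s} ≤-refl = ∧-zeroʳ _
    rightNbr-fresh (wrap a u d) (a1 , u1 , h) lt with wrap-gap {a} {u} h
    ... | c , e , e2 , ac rewrite e | ≤ᵇ-f {suc c} {suc a} (s≤s ac) | ≤ᵇ-f {suc a} {a} ≤-refl = refl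

    neg<Bpos : ∀ m k → 1 ≤ m → (neg m <B pos k) ≡ true
    neg<Bpos (suc m) k _ = refl

    neg≮Bneg1 : ∀ m → 1 ≤ m → (neg m <B neg 1) ≡ false
    neg≮Bneg1 (suc m) _ = refl

    neg<Bneg-suc : ∀ c → 1 ≤ c → (neg c <B neg (suc c)) ≡ true
    neg<Bneg-suc (suc c) _ = <ᵇ-t {c} {suc c} ≤-refl

    leftNbr-descent : ∀ st → WellFormed st → size st < n → (neg (leftNbr st) <B lastLetter st) ≡ desLeft st
    leftNbr-descent (seg zero s true) (s1 , _) lt = neg<Bpos n s (≤-trans s1 (<⇒≤ lt))
    leftNbr-descent (seg zero s false) (s1 , _) lt = neg≮Bneg1 n (≤-trans s1 (<⇒≤ lt))
    leftNbr-descent (seg (suc l) s true) _ _ = refl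
    leftNbr-descent (seg (suc l) s false) _ _ = <ᵇ-t {l} {suc l} ≤-refl
    leftNbr-descent (wrap a u true) (a1 , u1 , h) lt with wrap-gap {a} {u} h
    ... | c , e , e2 , ac rewrite e = neg<Bpos c a (≤-trans a1 (<⇒≤ ac))
    leftNbr-descent (wrap a u false) (a1 , u1 , h) lt with wrap-gap {a} {u} h
    ... | c , e , e2 , ac rewrite e = neg<Bneg-suc c (≤-trans a1 (<⇒≤ ac))

    rightNbr-descent : ∀ st → WellFormed st → size st < n → (pos (rightNbr st) <B lastLetter st) ≡ desRight st
    rightNbr-descent (seg l s true) (s1 , ls) lt with l + s ≟ n
    ... | yes e rewrite ≡ᵇ-t e | e = <ᵇ-t {1} {n} (≤-trans (s≤s s1) lt)
    ... | no ne rewrite ≡ᵇ-f ne = <ᵇ-f {suc (l + s)} {l + s} (n≤1+n _)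
    rightNbr-descent (seg l s false) (s1 , ls) lt with l + s ≟ n
    ... | yes e rewrite ≡ᵇ-t e = refl
    ... | no ne rewrite ≡ᵇ-f ne = refl
    rightNbr-descent (wrap a u true) _ _ = <ᵇ-f {suc a} {a} (n≤1+n _)
    rightNbr-descent (wrap a u false) _ _ = refl

    seg-member⇒ : ∀ {l s d m} → members (seg l s d) m ≡ true → (suc l ≤ m) × (m ≤ l + s)
    seg-member⇒ {l} {s} {d} {m} e = ≤ᵇ-sound {suc l} {m} (∧-elimˡ {suc l ≤ᵇ m} e) , ≤ᵇ-sound {m} {l + s} (∧-elimʳ {suc l ≤ᵇ m} e)

    seg-member⇐ : ∀ {l s d m} → suc l ≤ m → m ≤ l + s → members (seg l s d) m ≡ true
    seg-member⇐ {l} {s} {d} {m} p q = ∧-true (≤ᵇ-t {suc l} {m} p) (≤ᵇ-t {m} {l + s} q)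

    wrap-member⇒ : ∀ {a u d m} → members (wrap a u d) m ≡ true → (suc (n ∸ u) ≤ m) ⊎ (m ≤ a)
    wrap-member⇒ {a} {u} {d} {m} e with ∨-elim {suc (n ∸ u) ≤ᵇ m} e
    ... | inj₁ p = inj₁ (≤ᵇ-sound {suc (n ∸ u)} {m} p)
    ... | inj₂ p = inj₂ (≤ᵇ-sound {m} {a} p)

    wrap-member⇐ : ∀ {a u d m} → (suc (n ∸ u) ≤ m) ⊎ (m ≤ a) → members (wrap a u d) m ≡ true
    wrap-member⇐ {a} {u} {d} {m} (inj₁ p) = ∨-introˡ (m ≤ᵇ a) (≤ᵇ-t {suc (n ∸ u)} {m} p)
    wrap-member⇐ {a} {u} {d} {m} (inj₂ p) = ∨-introʳ (suc (n ∸ u) ≤ᵇ m) (≤ᵇ-t {m} {a} p)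

    suc∸1 : ∀ m → 1 ≤ m → suc (m ∸ 1) ≡ m
    suc∸1 (suc m) _ = refl

    sucn∸su : ∀ u → u < n → suc (n ∸ suc u) ≡ n ∸ u
    sucn∸su u h = trans (cong suc (sym (pred[m∸n]≡m∸[1+n] n u))) (suc∸1 (n ∸ u) (m<n⇒0<n∸m h))

    Adjoins : St → ℕ → St → Set
    Adjoins st v st' = ∀ m → 1 ≤ m → m ≤ n → (members st m ∨ (v ≡ᵇ m)) ≡ members st' m

    Transition : St → ℕ → ℤ → St → Set
    Transition st v letter st' = WellFormed st' × (size st' ≡ suc (size st)) × Adjoins st v st' × (lastLetter st' ≡ letter)

    adjoin-top : ∀ {s d} → 1 ≤ n → Adjoins (seg zero s d) n (wrap s 1 false)
    adjoin-top {s} {d} n≥1 m m1 mn = bool-ext to from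
      where
      to : (members (seg zero s d) m ∨ (n ≡ᵇ m)) ≡ true → members (wrap s 1 false) m ≡ true
      to e with ∨-elim {members (seg zero s d) m} e
      ... | inj₁ p = wrap-member⇐ {s} {1} {false} {m} (inj₂ (proj₂ (seg-member⇒ {zero} {s} {d} p)))
      ... | inj₂ p = wrap-member⇐ {s} {1} {false} {m} (inj₁ (≤-reflexive (trans (suc∸1 n n≥1) (≡ᵇ-sound {n} p))))
      from : members (wrap s 1 false) m ≡ true → (members (seg zero s d) m ∨ (n ≡ᵇ m)) ≡ true
      from e with wrap-member⇒ {s} {1} {false} {m} e
      ... | inj₁ p = ∨-introʳ (members (seg zero s d) m) (≡ᵇ-t {n} {m} (≤-antisym (subst (_≤ m) (suc∸1 n n≥1) p) mn))
      ... | inj₂ p = ∨-introˡ (n ≡ᵇ m) (seg-member⇐ {zero} {s} {d} {m} m1 p)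

    adjoin-below : ∀ {l s d} → 1 ≤ s → Adjoins (seg (suc l) s d) (suc l) (seg l (suc s) false)
    adjoin-below {l} {s} {d} s1 m m1 mn = bool-ext to from
      where
      to : (members (seg (suc l) s d) m ∨ (suc l ≡ᵇ m)) ≡ true → members (seg l (suc s) false) m ≡ true
      to e with ∨-elim {members (seg (suc l) s d) m} e
      ... | inj₁ p = let (a , b) = seg-member⇒ {suc l} {s} {d} p in
        seg-member⇐ {l} {suc s} {false} {m} (<⇒≤ a) (subst (m ≤_) (sym (+-suc l s)) b)
      ... | inj₂ p = seg-member⇐ {l} {suc s} {false} {m} (≤-reflexive (≡ᵇ-sound {suc l} p))
         (subst (_≤ l + suc s) (≡ᵇ-sound {suc l} p) (subst (suc l ≤_) (sym (+-suc l s)) (s≤s (≤-trans (m≤m+n l 1) (+-monoʳ-≤ l s1)))))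
      from : members (seg l (suc s) false) m ≡ true → (members (seg (suc l) s d) m ∨ (suc l ≡ᵇ m)) ≡ true
      from e with seg-member⇒ {l} {suc s} {false} {m} e
      ... | a , b with suc l ≟ m
      ...   | yes eq = ∨-introʳ (members (seg (suc l) s d) m) (≡ᵇ-t eq)
      ...   | no ne = ∨-introˡ (suc l ≡ᵇ m) (seg-member⇐ {suc l} {s} {d} {m} (≤∧≢⇒< a ne) (subst (m ≤_) (+-suc l s) b))

    adjoin-wrap-top : ∀ {a u d} → u < n → Adjoins (wrap a u d) (n ∸ u) (wrap a (suc u) false)
    adjoin-wrap-top {a} {u} {d} u<n m m1 mn = bool-ext to from
      where
      to : (members (wrap a u d) m ∨ (n ∸ u ≡ᵇ m)) ≡ true → members (wrap a (suc u) false) m ≡ true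
      to e with ∨-elim {members (wrap a u d) m} e
      ... | inj₁ p with wrap-member⇒ {a} {u} {d} {m} p
      ...   | inj₁ q = wrap-member⇐ {a} {suc u} {false} {m} (inj₁ (subst (_≤ m) (sym (sucn∸su u u<n)) (<⇒≤ q)))
      ...   | inj₂ q = wrap-member⇐ {a} {suc u} {false} {m} (inj₂ q)
      to e | inj₂ p = wrap-member⇐ {a} {suc u} {false} {m} (inj₁ (≤-reflexive (trans (sucn∸su u u<n) (≡ᵇ-sound {n ∸ u} p))))
      from : members (wrap a (suc u) false) m ≡ true → (members (wrap a u d) m ∨ (n ∸ u ≡ᵇ m)) ≡ true
      from e with wrap-member⇒ {a} {suc u} {false} {m} e
      ... | inj₂ q = ∨-introˡ (n ∸ u ≡ᵇ m) (wrap-member⇐ {a} {u} {d} {m} (inj₂ q))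
      ... | inj₁ q with n ∸ u ≟ m
      ...   | yes eq = ∨-introʳ (members (wrap a u d) m) (≡ᵇ-t eq)
      ...   | no ne = ∨-introˡ (n ∸ u ≡ᵇ m) (wrap-member⇐ {a} {u} {d} {m} (inj₁ (≤∧≢⇒< (subst (_≤ m) (sucn∸su u u<n) q) ne)))

    adjoin-bottom : ∀ {l s d} → l + s ≡ n → Adjoins (seg l s d) 1 (wrap 1 s true)
    adjoin-bottom {l} {s} {d} eq m m1 mn = bool-ext to from
      where
      l≡ : n ∸ s ≡ l
      l≡ = trans (cong (_∸ s) (sym eq)) (m+n∸n≡m l s)
      to : (members (seg l s d) m ∨ (1 ≡ᵇ m)) ≡ true → members (wrap 1 s true) m ≡ true
      to e with ∨-elim {members (seg l s d) m} e
      ... | inj₁ p = wrap-member⇐ {1} {s} {true} {m} (inj₁ (subst (_≤ m) (cong suc (sym l≡)) (proj₁ (seg-member⇒ {l} {s} {d} p))))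
      ... | inj₂ p = wrap-member⇐ {1} {s} {true} {m} (inj₂ (≤-reflexive (sym (≡ᵇ-sound {1} p))))
      from : members (wrap 1 s true) m ≡ true → (members (seg l s d) m ∨ (1 ≡ᵇ m)) ≡ true
      from e with wrap-member⇒ {1} {s} {true} {m} e
      ... | inj₁ q = ∨-introˡ (1 ≡ᵇ m) (seg-member⇐ {l} {s} {d} {m} (subst (_≤ m) (cong suc l≡) q) (subst (m ≤_) (sym eq) mn))
      ... | inj₂ q = ∨-introʳ (members (seg l s d) m) (≡ᵇ-t {1} {m} (≤-antisym m1 q))

    adjoin-above : ∀ {l s d} → Adjoins (seg l s d) (suc (l + s)) (seg l (suc s) true)
    adjoin-above {l} {s} {d} m m1 mn = bool-ext to from
      where
      to : (members (seg l s d) m ∨ (suc (l + s) ≡ᵇ m)) ≡ true → members (seg l (suc s) true) m ≡ true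
      to e with ∨-elim {members (seg l s d) m} e
      ... | inj₁ p = let (a , b) = seg-member⇒ {l} {s} {d} p in
        seg-member⇐ {l} {suc s} {true} {m} a (subst (m ≤_) (sym (+-suc l s)) (m≤n⇒m≤1+n b))
      ... | inj₂ p = seg-member⇐ {l} {suc s} {true} {m} (subst (suc l ≤_) (≡ᵇ-sound {suc (l + s)} p) (s≤s (m≤m+n l s)))
         (≤-reflexive (trans (sym (≡ᵇ-sound {suc (l + s)} p)) (sym (+-suc l s))))
      from : members (seg l (suc s) true) m ≡ true → (members (seg l s d) m ∨ (suc (l + s) ≡ᵇ m)) ≡ true
      from e with seg-member⇒ {l} {suc s} {true} {m} e
      ... | a , b with suc (l + s) ≟ m
      ...   | yes eq = ∨-introʳ (members (seg l s d) m) (≡ᵇ-t eq)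
      ...   | no ne = ∨-introˡ (suc (l + s) ≡ᵇ m) (seg-member⇐ {l} {s} {d} {m} a
                (s≤s⁻¹ (≤∧≢⇒< (subst (m ≤_) (+-suc l s) b) (λ e' → ne (sym e')))))

    adjoin-wrap-bottom : ∀ {a u d} → Adjoins (wrap a u d) (suc a) (wrap (suc a) u true)
    adjoin-wrap-bottom {a} {u} {d} m m1 mn = bool-ext to from
      where
      to : (members (wrap a u d) m ∨ (suc a ≡ᵇ m)) ≡ true → members (wrap (suc a) u true) m ≡ true
      to e with ∨-elim {members (wrap a u d) m} e
      ... | inj₁ p with wrap-member⇒ {a} {u} {d} {m} p
      ...   | inj₁ q = wrap-member⇐ {suc a} {u} {true} {m} (inj₁ q)
      ...   | inj₂ q = wrap-member⇐ {suc a} {u} {true} {m} (inj₂ (m≤n⇒m≤1+n q))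
      to e | inj₂ p = wrap-member⇐ {suc a} {u} {true} {m} (inj₂ (≤-reflexive (sym (≡ᵇ-sound {suc a} p))))
      from : members (wrap (suc a) u true) m ≡ true → (members (wrap a u d) m ∨ (suc a ≡ᵇ m)) ≡ true
      from e with wrap-member⇒ {suc a} {u} {true} {m} e
      ... | inj₁ q = ∨-introˡ (suc a ≡ᵇ m) (wrap-member⇐ {a} {u} {d} {m} (inj₁ q))
      ... | inj₂ q with suc a ≟ m
      ...   | yes eq = ∨-introʳ (members (wrap a u d) m) (≡ᵇ-t eq)
      ...   | no ne = ∨-introˡ (suc a ≡ᵇ m) (wrap-member⇐ {a} {u} {d} {m} (inj₂ (s≤s⁻¹ (≤∧≢⇒< q (λ e' → ne (sym e'))))))

    leftNbr-transition : ∀ st → WellFormed st → suc (size st) < n → Transition st (leftNbr st) (neg (leftNbr st)) (growLeft st)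
    leftNbr-transition (seg zero s d) (s1 , ls) lt =
      (s1 , ≤-refl , subst (_< n) (+-comm 1 s) lt) , +-comm s 1 , adjoin-top {s} {d} n≥1 , cong neg (suc∸1 n n≥1)
      where
      n≥1 = ≤-trans s1 (<⇒≤ (<-trans (n<1+n s) lt))
    leftNbr-transition (seg (suc l) s d) (s1 , ls) lt =
      (s≤s z≤n , subst (_≤ n) (sym (+-suc l s)) ls) , refl , adjoin-below {l} {s} {d} s1 , refl
    leftNbr-transition (wrap a u d) (a1 , u1 , h) lt =
      (a1 , s≤s z≤n , subst (_< n) (sym (+-suc a u)) lt) , +-suc a u , adjoin-wrap-top {a} {u} {d} u<n , cong neg (sucn∸su u u<n)
      where
      u<n = ≤-<-trans (m≤n+m u a) h

    rightNbr-transition : ∀ st → WellFormed st → suc (size st) < n → Transition st (rightNbr st) (pos (rightNbr st)) (growRight st)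
    rightNbr-transition (seg l s d) (s1 , ls) lt with l + s ≟ n
    ... | yes eq rewrite ≡ᵇ-t eq = (≤-refl , s1 , lt) , refl , adjoin-bottom {l} {s} {d} eq , refl
    ... | no ne rewrite ≡ᵇ-f ne =
      (s≤s z≤n , subst (_≤ n) (sym (+-suc l s)) (≤∧≢⇒< ls ne)) , refl , adjoin-above {l} {s} {d} , cong pos (+-suc l s)
    rightNbr-transition (wrap a u d) (a1 , u1 , h) lt = (s≤s z≤n , u1 , lt) , refl , adjoin-wrap-bottom {a} {u} {d} , refl

    seg-below : ∀ {l s d m} → m < suc l → members (seg l s d) m ≡ false
    seg-below {l} {s} {d} {m} p rewrite ≤ᵇ-f {suc l} {m} p = refl

    seg-above : ∀ {l s d m} → l + s < m → members (seg l s d) m ≡ false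
    seg-above {l} {s} {d} {m} p rewrite ≤ᵇ-f {m} {l + s} p = ∧-zeroʳ _

    wrap-gap-free : ∀ {a u d m} → a < m → m < suc (n ∸ u) → members (wrap a u d) m ≡ false
    wrap-gap-free {a} {u} {d} {m} p q rewrite ≤ᵇ-f {suc (n ∸ u)} {m} q | ≤ᵇ-f {m} {a} p = refl

    members-interval : ∀ st → WellFormed st → isInterval n (members st) ≡ true
    members-interval (seg l s d) (s1 , ls) =
      isInterval-segment n (members (seg l s d)) (suc l) (l + s) (s≤s z≤n)
        (subst (_≤ l + s) (+-comm l 1) (+-monoʳ-≤ l s1)) ls (λ m → refl)
    members-interval (wrap a u d) (a1 , u1 , h) with wrap-gap {a} {u} h
    ... | c , e , e2 , ac =
      isInterval-wrapped n (members (wrap a u d)) a (suc (n ∸ u)) a1 (subst (λ z → a ≤ suc z) (sym e) (≤-trans (<⇒≤ ac) (n≤1+n c)))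
        (subst (λ z → suc z ≤ n) (sym e) (subst (suc c ≤_) e2 (subst (_≤ c + u) (+-comm c 1) (+-monoʳ-≤ c u1))))
        (λ m → refl)

    predZn-s : ∀ m → 1 ≤ m → predZn n (suc m) ≡ m
    predZn-s (suc m) _ = refl

    succZn-n : succZn n n ≡ 1
    succZn-n rewrite ≡ᵇ-t {n} {n} refl = refl

    succZn-lt : ∀ m → m < n → succZn n m ≡ suc m
    succZn-lt m p rewrite ≡ᵇ-f {m} {n} (<⇒≢ p) = refl

    predZn-ge2 : ∀ m → 2 ≤ m → predZn n m ≡ m ∸ 1
    predZn-ge2 (suc (suc k)) _ = refl
    predZn-ge2 (suc zero) (s≤s ())

    wrap-outside : ∀ {a u d m c} → n ∸ u ≡ c → a < m → m < suc c → members (wrap a u d) m ≡ false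
    wrap-outside {a} {u} {d} {m} {c} e p q = wrap-gap-free {a} {u} {d} {m} p (subst (λ z → m < suc z) (sym e) q)

    wrap-inside : ∀ {a u d m c} → n ∸ u ≡ c → (suc c ≤ m) ⊎ (m ≤ a) → members (wrap a u d) m ≡ true
    wrap-inside {a} {u} {d} {m} {c} e (inj₁ p) = wrap-member⇐ {a} {u} {d} {m} (inj₁ (subst (λ z → suc z ≤ m) (sym e) p))
    wrap-inside {a} {u} {d} {m} {c} e (inj₂ p) = wrap-member⇐ {a} {u} {d} {m} (inj₂ p)

    record WrapData (a u : ℕ) : Set where
      field
        c : ℕ
        e : n ∸ u ≡ c
        e2 : c + u ≡ n
        ac : a < c

    wrapData : ∀ {a u} → a + u < n → WrapData a u
    wrapData {a} {u} h with wrap-gap {a} {u} h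
    ... | c , e , e2 , ac = record { c = c ; e = e ; e2 = e2 ; ac = ac }

    wrap-gap-wide : ∀ {a u c} → c + u ≡ n → suc (a + u) < n → suc a < c
    wrap-gap-wide {a} {u} {c} e2 lt = +-cancelʳ-< u (suc a) c (subst (suc (a + u) <_) (sym e2) lt)

    wrap-top<n : ∀ {c u} → 1 ≤ u → c + u ≡ n → c < n
    wrap-top<n {c} {u} u1 e2 = subst (c <_) e2 (subst (_≤ c + u) (+-comm c 1) (+-monoʳ-≤ c u1))

    -- Sign rule for -λ: the cyclic predecessor of λ is still fresh (before the last position),
    -- so the arc condition does not force the letter λ to be positive.
    leftNbr-pred-fresh : ∀ st → WellFormed st → suc (size st) < n → members st (predZn n (leftNbr st)) ≡ false
    leftNbr-pred-fresh (seg zero s d) (s1 , ls) lt rewrite predZn-ge2 n (≤-trans (s≤s s1) (<⇒≤ lt)) =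
      seg-above {0} {s} {d} (m+n≤o⇒m≤o∸n (suc s) (subst (_≤ n) (+-comm 1 (suc s)) lt))
    leftNbr-pred-fresh (seg (suc zero) s d) (s1 , ls) lt = seg-above {1} {s} {d} lt
    leftNbr-pred-fresh (seg (suc (suc l)) s d) (s1 , ls) lt = seg-below {suc (suc l)} {s} {d} {suc l} (≤-trans (n<1+n _) (n≤1+n _))
    leftNbr-pred-fresh (wrap a u d) (a1 , u1 , h) lt with wrapData {a} {u} h
    ... | record { c = c ; e = e ; e2 = e2 ; ac = ac } with wrap-gap-wide {a} {u} {c} e2 lt
    ... | sac with c | e | sac
    ...   | suc c' | e' | s≤s ac' =
      trans (cong (λ z → members (wrap a u d) (predZn n z)) e')
            (trans (cong (members (wrap a u d)) (predZn-s c' (≤-trans a1 (<⇒≤ ac'))))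
                   (wrap-outside {a} {u} {d} {c'} e' ac' (≤-trans (n<1+n _) (n≤1+n _))))

    sl≤ls : ∀ l s → 1 ≤ s → suc l ≤ l + s
    sl≤ls l s s1 = subst (_≤ l + s) (+-comm l 1) (+-monoʳ-≤ l s1)

    rightNbr-succ-fresh : ∀ st → WellFormed st → suc (size st) < n → members st (succZn n (rightNbr st)) ≡ false
    rightNbr-succ-fresh (seg l s d) (s1 , ls) lt with l + s ≟ n
    ... | yes eq rewrite ≡ᵇ-t eq | succZn-lt 1 (≤-trans (s≤s s1) (<⇒≤ lt)) =
      seg-below {l} {s} {d} {2} (s≤s (+-cancelʳ-≤ s 2 l (subst (2 + s ≤_) (sym eq) lt)))
    ... | no ne rewrite ≡ᵇ-f ne with suc (l + s) ≟ n
    ...   | yes eq2 rewrite ≡ᵇ-t eq2 = seg-below {l} {s} {d} {1}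
              (s≤s (+-cancelʳ-≤ s 1 l (s≤s⁻¹ (subst (suc (suc s) ≤_) (sym eq2) lt))))
    ...   | no ne2 rewrite ≡ᵇ-f ne2 = seg-above {l} {s} {d} (≤-trans (n<1+n _) (n≤1+n _))
    rightNbr-succ-fresh (wrap a u d) (a1 , u1 , h) lt with wrapData {a} {u} h
    ... | record { c = c ; e = e ; e2 = e2 ; ac = ac } =
      trans (cong (members (wrap a u d)) (succZn-lt (suc a) (≤-<-trans (s≤s (m≤m+n a u)) lt)))
            (wrap-outside {a} {u} {d} {suc (suc a)} e (≤-trans (n<1+n _) (n≤1+n _)) (s≤s (wrap-gap-wide {a} {u} {c} e2 lt)))

    -- The successor of λ and the predecessor of ρ are already used, which forces the
    -- signs: λ must be negative and ρ positive.
    leftNbr-succ-member : ∀ st → WellFormed st → size st < n → members st (succZn n (leftNbr st)) ≡ true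
    leftNbr-succ-member (seg zero s d) (s1 , ls) lt rewrite succZn-n = seg-member⇐ {0} {s} {d} {1} ≤-refl s1
    leftNbr-succ-member (seg (suc l) s d) (s1 , ls) lt rewrite succZn-lt (suc l) (≤-trans (s≤s (sl≤ls l s s1)) ls) =
      seg-member⇐ {suc l} {s} {d} {suc (suc l)} ≤-refl (s≤s (sl≤ls l s s1))
    leftNbr-succ-member (wrap a u d) (a1 , u1 , h) lt with wrapData {a} {u} h
    ... | record { c = c ; e = e ; e2 = e2 ; ac = ac } =
      trans (cong (λ z → members (wrap a u d) (succZn n z)) e)
       (trans (cong (members (wrap a u d)) (succZn-lt c (wrap-top<n u1 e2)))
         (wrap-inside {a} {u} {d} {suc c} e (inj₁ ≤-refl)))

    rightNbr-pred-member : ∀ st → WellFormed st → size st < n → members st (predZn n (rightNbr st)) ≡ true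
    rightNbr-pred-member (seg l s d) (s1 , ls) lt with l + s ≟ n
    ... | yes eq rewrite ≡ᵇ-t eq = seg-member⇐ {l} {s} {d} {n} (subst (suc l ≤_) eq (sl≤ls l s s1)) (≤-reflexive (sym eq))
    ... | no ne rewrite ≡ᵇ-f ne | predZn-s (l + s) (≤-trans s1 (m≤n+m s l)) =
      seg-member⇐ {l} {s} {d} {l + s} (sl≤ls l s s1) ≤-refl
    rightNbr-pred-member (wrap a u d) (a1 , u1 , h) lt rewrite predZn-s a a1 = wrap-member⇐ {a} {u} {d} {a} (inj₂ ≤-refl)

    module _ (st : St) (v : ℕ) where
      withValue : ℕ → Bool
      withValue m = members st m ∨ (v ≡ᵇ m)

      withValue-old : ∀ {m} → members st m ≡ true → withValue m ≡ true
      withValue-old {m} p = ∨-introˡ (v ≡ᵇ m) p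

      withValue-new : withValue v ≡ true
      withValue-new = ∨-introʳ (members st v) (≡ᵇ-t {v} refl)

      withValue-outside : ∀ {m} → members st m ≡ false → v ≢ m → withValue m ≡ false
      withValue-outside {m} p q rewrite p = ≡ᵇ-f q

    rightNbr-inner : ∀ l s d → l + s ≢ n → rightNbr (seg l s d) ≡ suc (l + s)
    rightNbr-inner l s d ne rewrite ≡ᵇ-f ne = refl

    rightNbr-wraps : ∀ l s d → l + s ≡ n → rightNbr (seg l s d) ≡ 1
    rightNbr-wraps l s d eq rewrite ≡ᵇ-t eq = refl

    -- In the state {1..s}, a fresh value v ∉ {s+1, n} sits strictly between s+1 and n:
    -- the pattern 1 ∈, s+1 ∉, v ∈, n ∉ is not an interval.
    breaks-initial-seg : ∀ {s d} → 1 ≤ s → suc s < n → ∀ v → 1 ≤ v → v ≤ n → members (seg zero s d) v ≡ false →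
      v ≢ n → v ≢ suc s → isInterval n (withValue (seg zero s d) v) ≡ false
    breaks-initial-seg {s} {d} s1 lt v v1 vn mf nl nr =
      alternating-not-interval n (withValue st v) true 1 (suc s) v n ≤-refl (s≤s s1) h23 (≤∧≢⇒< vn nl) ≤-refl
        (withValue-old st v (seg-member⇐ {0} {s} {d} {1} ≤-refl s1))
        (withValue-outside st v (seg-above {0} {s} {d} {suc s} ≤-refl) nr)
        (withValue-new st v)
        (withValue-outside st v (seg-above {0} {s} {d} {n} (<-trans (n<1+n s) lt)) nl)
      where
      st = seg zero s d
      s<v : s < v
      s<v with v ≤? s
      ... | yes p = ⊥-elim (false≢true mf (seg-member⇐ {0} {s} {d} {v} v1 p))
      ... | no p = ≰⇒> p
      h23 : suc s < v
      h23 = ≤∧≢⇒< s<v (λ e → nr (sym e))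

    -- Below a segment {l+2..l+1+s}, a value v < l+1 other than the right neighbour breaks the
    -- interval: v ∈, l+1 ∉, l+2 ∈, l+s+2 ∉ if the segment stops before n, and otherwise
    -- 1 ∉, v ∈, l+1 ∉, l+2 ∈ (the right neighbour then being 1).
    breaks-below-seg : ∀ {l s d} → 1 ≤ s → suc l + s ≤ n → ∀ v → 1 ≤ v → v < suc l →
      v ≢ rightNbr (seg (suc l) s d) → isInterval n (withValue (seg (suc l) s d) v) ≡ false
    breaks-below-seg {l} {s} {d} s1 ls v v1 v<sl nr with suc l + s ≟ n
    ... | no ne =
      alternating-not-interval n (withValue st v) true v (suc l) (suc (suc l)) (suc (suc l + s)) v1 v<sl ≤-refl
        (s≤s (s≤s (sl≤ls l s s1))) (≤∧≢⇒< ls ne)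
        (withValue-new st v)
        (withValue-outside st v (seg-below {suc l} {s} {d} {suc l} ≤-refl) (<⇒≢ v<sl))
        (withValue-old st v (seg-member⇐ {suc l} {s} {d} {suc (suc l)} ≤-refl (s≤s (sl≤ls l s s1))))
        (withValue-outside st v (seg-above {suc l} {s} {d} {suc (suc l + s)} ≤-refl)
          (λ e → <-irrefl e (<-trans v<sl (s≤s (s≤s (m≤m+n l s))))))
      where
      st = seg (suc l) s d
    ... | yes eq =
      alternating-not-interval n (withValue st v) false 1 v (suc l) (suc (suc l)) ≤-refl (≤∧≢⇒< v1 (λ e → nr' (sym e))) v<sl ≤-refl
        (subst (suc (suc l) ≤_) eq (s≤s (sl≤ls l s s1)))
        (withValue-outside st v (seg-below {suc l} {s} {d} {1} (s≤s (s≤s z≤n))) nr')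
        (withValue-new st v)
        (withValue-outside st v (seg-below {suc l} {s} {d} {suc l} ≤-refl) (<⇒≢ v<sl))
        (withValue-old st v (seg-member⇐ {suc l} {s} {d} {suc (suc l)} ≤-refl (s≤s (sl≤ls l s s1))))
      where
      st = seg (suc l) s d
      nr' : v ≢ 1
      nr' = subst (v ≢_) (rightNbr-wraps (suc l) s d eq) nr

    -- Above a segment {l+2..l+1+s}, a value v > l+s+2 breaks the interval:
    -- l+1 ∉, l+2 ∈, l+s+2 ∉, v ∈.
    breaks-above-seg : ∀ {l s d} → 1 ≤ s → ∀ v → suc l + s < v → v ≤ n →
      v ≢ rightNbr (seg (suc l) s d) → isInterval n (withValue (seg (suc l) s d) v) ≡ false
    breaks-above-seg {l} {s} {d} s1 v ls<v vn nr =
      alternating-not-interval n (withValue st v) false (suc l) (suc (suc l)) (suc (suc l + s)) v (s≤s z≤n) ≤-refl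
        (s≤s (s≤s (sl≤ls l s s1))) h34 vn
        (withValue-outside st v (seg-below {suc l} {s} {d} {suc l} ≤-refl)
          (λ e → <-irrefl (sym e) (≤-trans (s≤s (m≤m+n (suc l) s)) ls<v)))
        (withValue-old st v (seg-member⇐ {suc l} {s} {d} {suc (suc l)} ≤-refl (s≤s (sl≤ls l s s1))))
        (withValue-outside st v (seg-above {suc l} {s} {d} {suc (suc l + s)} ≤-refl) nr')
        (withValue-new st v)
      where
      st = seg (suc l) s d
      nr' : v ≢ suc (suc l + s)
      nr' = subst (v ≢_) (rightNbr-inner (suc l) s d (λ e → <-irrefl refl (≤-trans ls<v (subst (v ≤_) (sym e) vn)))) nr
      h34 : suc (suc l + s) < v
      h34 = ≤∧≢⇒< ls<v (λ e → nr' (sym e))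

    -- In a wrapped state {1..a} ∪ {c+1..n}, a fresh value v ∉ {a+1, c} breaks the interval:
    -- a ∈, a+1 ∉, v ∈, c ∉.
    breaks-wrap : ∀ {a u d} → 1 ≤ a → 1 ≤ u → a + u < n → ∀ v → v ≤ n → members (wrap a u d) v ≡ false →
      v ≢ n ∸ u → v ≢ suc a → isInterval n (withValue (wrap a u d) v) ≡ false
    breaks-wrap {a} {u} {d} a1 u1 h v vn mf nl nr with wrapData {a} {u} h
    ... | record { c = c ; e = e ; e2 = e2 ; ac = ac } =
      alternating-not-interval n (withValue st v) true a (suc a) v c a1 ≤-refl
        (≤∧≢⇒< a<v (λ q → nr (sym q))) (≤∧≢⇒< (s≤s⁻¹ v<sc) nl') (<⇒≤ (wrap-top<n u1 e2))
        (withValue-old st v (wrap-inside {a} {u} {d} {a} e (inj₂ ≤-refl)))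
        (withValue-outside st v (wrap-outside {a} {u} {d} {suc a} e ≤-refl (s≤s ac)) nr)
        (withValue-new st v)
        (withValue-outside st v (wrap-outside {a} {u} {d} {c} e ac ≤-refl) nl')
      where
      st = wrap a u d
      nl' : v ≢ c
      nl' = subst (v ≢_) e nl
      v<sc : v < suc c
      v<sc with suc c ≤? v
      ... | yes q = ⊥-elim (false≢true mf (wrap-inside {a} {u} {d} {v} e (inj₁ q)))
      ... | no q = ≰⇒> q
      a<v : a < v
      a<v with v ≤? a
      ... | yes q = ⊥-elim (false≢true mf (wrap-inside {a} {u} {d} {v} e (inj₂ q)))
      ... | no q = ≰⇒> q

    other-letter-breaks-interval : ∀ st → WellFormed st → suc (size st) < n → ∀ v → 1 ≤ v → v ≤ n → members st v ≡ false →
      v ≢ leftNbr st → v ≢ rightNbr st → isInterval n (withValue st v) ≡ false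
    other-letter-breaks-interval (seg zero s d) (s1 , ls) lt v v1 vn mf nl nr =
      breaks-initial-seg {s} {d} s1 lt v v1 vn mf nl (subst (v ≢_) (rightNbr-inner 0 s d (<⇒≢ (<-trans (n<1+n s) lt))) nr)
    other-letter-breaks-interval (seg (suc l) s d) (s1 , ls) lt v v1 vn mf nl nr with suc (suc l) ≤? v
    ... | no p = breaks-below-seg {l} {s} {d} s1 ls v v1 (≤∧≢⇒< (s≤s⁻¹ (≰⇒> p)) nl) nr
    ... | yes p = breaks-above-seg {l} {s} {d} s1 v ls<v vn nr
      where
      ls<v : suc l + s < v
      ls<v with v ≤? suc l + s
      ... | yes q = ⊥-elim (false≢true mf (seg-member⇐ {suc l} {s} {d} {v} p q))
      ... | no q = ≰⇒> q
    other-letter-breaks-interval (wrap a u d) (a1 , u1 , h) lt v v1 vn mf nl nr =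
      breaks-wrap {a} {u} {d} a1 u1 h v vn mf nl nr

    last-letter-forced : ∀ st → WellFormed st → suc (size st) ≡ n → (leftNbr st ≡ rightNbr st) × (∀ v → 1 ≤ v → v ≤ n → members st v ≡ false → v ≡ leftNbr st)
    last-letter-forced (seg zero s d) (s1 , ls) eq = sym (trans (rightNbr-inner 0 s d (λ q → <-irrefl (trans q (sym eq)) (n<1+n s))) eq) , f
      where
      f : ∀ v → 1 ≤ v → v ≤ n → members (seg zero s d) v ≡ false → v ≡ n
      f v v1 vn mf with v ≤? s
      ... | yes q = ⊥-elim (false≢true mf (seg-member⇐ {0} {s} {d} {v} v1 q))
      ... | no q = ≤-antisym vn (subst (_≤ v) eq (≰⇒> q))
    last-letter-forced (seg (suc zero) s d) (s1 , ls) eq = sym (rightNbr-wraps 1 s d eq) , f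
      where
      f : ∀ v → 1 ≤ v → v ≤ n → members (seg 1 s d) v ≡ false → v ≡ 1
      f v v1 vn mf with 2 ≤? v
      ... | yes q = ⊥-elim (false≢true mf (seg-member⇐ {1} {s} {d} {v} q (subst (v ≤_) (sym eq) vn)))
      ... | no q = ≤-antisym (s≤s⁻¹ (≰⇒> q)) v1
    last-letter-forced (seg (suc (suc l)) s d) (s1 , ls) eq =
      ⊥-elim (<-irrefl refl (≤-trans (s≤s (m≤n+m s l)) (s≤s⁻¹ (subst (suc (suc (l + s)) ≤_) (sym eq) ls))))
    last-letter-forced (wrap a u d) (a1 , u1 , h) eq with wrapData {a} {u} h
    ... | record { c = c ; e = e ; e2 = e2 ; ac = ac } = trans e c≡ , f
      where
      c≡ : c ≡ suc a
      c≡ = +-cancelʳ-≡ u c (suc a) (trans e2 (sym eq))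
      f : ∀ v → 1 ≤ v → v ≤ n → members (wrap a u d) v ≡ false → v ≡ n ∸ u
      f v v1 vn mf with suc c ≤? v | v ≤? a
      ... | yes q | _ = ⊥-elim (false≢true mf (wrap-inside {a} {u} {d} {v} e (inj₁ q)))
      ... | no _ | yes q = ⊥-elim (false≢true mf (wrap-inside {a} {u} {d} {v} e (inj₂ q)))
      ... | no q1 | no q2 = trans (≤-antisym (s≤s⁻¹ (≰⇒> q1)) (subst (_≤ v) (sym c≡) (≰⇒> q2))) (sym e)

  module GoodPrefixes (n : ℕ) where

    open Ranges
    open Windows
    open States n

    leftNbr-compare : ∀ st → WellFormed st → size st < n → ∀ m → m ≤ n → members st m ≡ true → (leftNbr st <ᵇ m) ≡ aboveLeft st m
    leftNbr-compare (seg zero s d) wf lt m mn mt = <ᵇ-f {n} {m} mn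
    leftNbr-compare (seg (suc l) s d) wf lt m mn mt = <ᵇ-t {suc l} {m} (proj₁ (seg-member⇒ {suc l} {s} {d} {m} mt))
    leftNbr-compare (wrap a u d) wf lt m mn mt = refl

    rightNbr-compare : ∀ st → WellFormed st → size st < n → ∀ m → m ≤ n → members st m ≡ true → (rightNbr st <ᵇ m) ≡ aboveRight st m
    rightNbr-compare (seg l s d) (s1 , ls) lt m mn mt with l + s ≟ n
    ... | yes eq rewrite ≡ᵇ-t eq = <ᵇ-t {1} {m} (≤-trans (s≤s (s≤s z≤n)) (subst (_≤ m) refl (≤-trans (s≤s (offset-positive l s lt eq)) (proj₁ (seg-member⇒ {l} {s} {d} {m} mt)))))
    ... | no ne rewrite ≡ᵇ-f ne = <ᵇ-f {suc (l + s)} {m} (m≤n⇒m≤1+n (proj₂ (seg-member⇒ {l} {s} {d} {m} mt)))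
    rightNbr-compare (wrap a u d) (a1 , u1 , h) lt m mn mt with wrapData {a} {u} h
    ... | record { c = c ; e = e ; e2 = e2 ; ac = ac } with wrap-member⇒ {a} {u} {d} {m} mt
    ... | inj₁ q rewrite e = trans (<ᵇ-t {suc a} {m} (≤-trans (s≤s ac) q)) (sym (<ᵇ-t {c} {m} q))
    ... | inj₂ q rewrite e = trans (<ᵇ-f {suc a} {m} (m≤n⇒m≤1+n q)) (sym (<ᵇ-f {c} {m} (≤-trans q (<⇒≤ ac))))

    predZn-range : ∀ m → 1 ≤ n → 1 ≤ m → m ≤ n → (1 ≤ predZn n m) × (predZn n m ≤ n)
    predZn-range (suc zero) n1 _ _ = n1 , ≤-refl
    predZn-range (suc (suc m)) n1 _ mn = s≤s z≤n , ≤-trans (n≤1+n _) mn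

    succZn-range : ∀ m → 1 ≤ n → 1 ≤ m → m ≤ n → (1 ≤ succZn n m) × (succZn n m ≤ n)
    succZn-range m n1 m1 mn with m ≟ n
    ... | yes eq rewrite ≡ᵇ-t eq = ≤-refl , n1
    ... | no ne rewrite ≡ᵇ-f ne = s≤s z≤n , ≤∧≢⇒< mn ne

    arcCond-++ : ∀ (p w : List ℤ) i → 1 ≤ i → i ≤ length p → arcCond n (p ++ w) i ≡ arcCond n p i
    arcCond-++ p w i h1 h2 =
      cong₂ _∧_ (isInterval-cong n _ _ (λ m _ _ → inPrefix-++ p w i m h2))
        (cong₂ _∧_
          (cong₂ _∨_ (cong not (trans (inPrefix-++ p w (i ∸ 1) _ (≤-trans (m∸n≤m i 1) h2))
                                      (cong (λ z → inPrefix p (i ∸ 1) (predZn n z)) (absAt-++ p w i h1 h2))))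
                     (cong isPosZ (at-++ p w i h1 h2)))
          (cong₂ _∨_ (cong not (trans (inPrefix-++ p w (i ∸ 1) _ (≤-trans (m∸n≤m i 1) h2))
                                      (cong (λ z → inPrefix p (i ∸ 1) (succZn n z)) (absAt-++ p w i h1 h2))))
                     (cong isNegZ (at-++ p w i h1 h2))))

    -- For wrapped states we also need the number of values above the lower cut n-u, which is u.
    CountInv : List ℤ → St → Set
    CountInv p (seg l s d) = ⊤
    CountInv p (wrap a u d) = nsum (fromTo 1 (a + u)) (λ i → ind (n ∸ u <ᵇ absAt p i)) ≡ u

    record Good (p : List ℤ) (st : St) : Set where
      field
        wf : WellFormed st
        small : size st < n
        len : length p ≡ size st
        inRange : ∀ i → 1 ≤ i → i ≤ size st → (1 ≤ absAt p i) × (absAt p i ≤ n)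
        prefixIs : ∀ m → 1 ≤ m → m ≤ n → inPrefix p (size st) m ≡ members st m
        lastIs : at p (size st) ≡ lastLetter st
        distinct : ∀ i j → 1 ≤ i → i < j → j ≤ size st → absAt p i ≢ absAt p j
        arcOK : ∀ i → 2 ≤ i → i ≤ size st → arcCond n p i ≡ true
        countOK : CountInv p st

    module _ {p st} (G : Good p st) where
      open Good G
      members-prefix : ∀ i → 1 ≤ i → i ≤ size st → members st (absAt p i) ≡ true
      members-prefix i h1 h2 = trans (sym (prefixIs (absAt p i) (proj₁ (inRange i h1 h2)) (proj₂ (inRange i h1 h2))))
                          (inPrefix-true p (size st) i h1 h2)

      exceedCount : (b : ℕ) → ℕ
      exceedCount b = nsum (fromTo 1 (size st)) (λ i → ind (b <ᵇ absAt p i))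

    nsum-const : ∀ l b → nsum l (λ _ → ind b) ≡ (if b then length l else 0)
    nsum-const [] true = refl
    nsum-const [] false = refl
    nsum-const (x ∷ l) true = cong suc (nsum-const l true)
    nsum-const (x ∷ l) false = nsum-const l false

    module GoodProps {p st} (G : Good p st) where
      open Good G

      exceedCount-via : (b : ℕ) (f : ℕ → Bool) → (∀ m → m ≤ n → members st m ≡ true → (b <ᵇ m) ≡ f m) →
        exceedCount G b ≡ nsum (fromTo 1 (size st)) (λ i → ind (f (absAt p i)))
      exceedCount-via b f h = nsum-cong (fromTo 1 (size st)) (λ i mm →
        let (i1 , i2) = fromTo-∈⁻ mm in cong ind (h (absAt p i) (proj₂ (inRange i i1 i2)) (members-prefix G i i1 i2)))

      exceedCount-left : exceedCount G (leftNbr st) ≡ invLeft st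
      exceedCount-left = trans (exceedCount-via (leftNbr st) (aboveLeft st) (λ m mn mt → leftNbr-compare st wf small m mn mt)) (by-state st countOK)
        where
        by-state : ∀ st' → CountInv p st' → nsum (fromTo 1 (size st')) (λ i → ind (aboveLeft st' (absAt p i))) ≡ invLeft st'
        by-state (seg zero s d) _ = nsum-const (fromTo 1 s) false
        by-state (seg (suc l) s d) _ = trans (nsum-const (fromTo 1 s) true) (length-fromTo1 s)
        by-state (wrap a u d) c = c

      exceedCount-right : exceedCount G (rightNbr st) ≡ invRight st
      exceedCount-right = trans (exceedCount-via (rightNbr st) (aboveRight st) (λ m mn mt → rightNbr-compare st wf small m mn mt)) (by-state st countOK)
        where
        by-state : ∀ st' → CountInv p st' → nsum (fromTo 1 (size st')) (λ i → ind (aboveRight st' (absAt p i))) ≡ invRight st'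
        by-state (seg l s d) _ with l + s ≡ᵇ n
        ... | true = trans (nsum-const (fromTo 1 s) true) (length-fromTo1 s)
        ... | false = nsum-const (fromTo 1 s) false
        by-state (wrap a u d) c = c

      module _ (letter : ℤ) (w : List ℤ) where
        q : List ℤ
        q = p ++ letter ∷ w

        at-new : at q (suc (size st)) ≡ letter
        at-new = subst (λ z → at q (suc z) ≡ letter) len (at-snoc p letter w)

        absAt-old : ∀ i → 1 ≤ i → i ≤ size st → absAt q i ≡ absAt p i
        absAt-old i h1 h2 = absAt-++ p (letter ∷ w) i h1 (subst (i ≤_) (sym len) h2)

        prefixSet-new : ∀ m → 1 ≤ m → m ≤ n → inPrefix q (suc (size st)) m ≡ withValue st ∣ letter ∣ m
        prefixSet-new m m1 mn = trans (subst (λ z → inPrefix q (suc z) m ≡ (inPrefix p z m ∨ (∣ letter ∣ ≡ᵇ m))) len (inPrefix-snoc p letter w m))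
                           (cong (_∨ (∣ letter ∣ ≡ᵇ m)) (prefixIs m m1 mn))

        prefixSet-old : ∀ m → 1 ≤ m → m ≤ n → inPrefix q (size st) m ≡ members st m
        prefixSet-old m m1 mn = trans (inPrefix-++ p (letter ∷ w) (size st) m (≤-reflexive (sym len))) (prefixIs m m1 mn)

        arcCond-new : 1 ≤ ∣ letter ∣ → ∣ letter ∣ ≤ n → arcCond n q (suc (size st)) ≡
          (isInterval n (withValue st ∣ letter ∣) ∧ ((not (members st (predZn n ∣ letter ∣)) ∨ isPosZ letter) ∧
                                              (not (members st (succZn n ∣ letter ∣)) ∨ isNegZ letter)))
        arcCond-new v1 vn = cong₂ _∧_ (isInterval-cong n _ _ prefixSet-new)
          (cong₂ _∧_
            (cong₂ _∨_ (cong not (trans (cong (λ z → inPrefix q (size st) (predZn n ∣ z ∣)) at-new)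
                         (prefixSet-old _ (proj₁ (predZn-range _ n1 v1 vn)) (proj₂ (predZn-range _ n1 v1 vn)))))
                       (cong isPosZ at-new))
            (cong₂ _∨_ (cong not (trans (cong (λ z → inPrefix q (size st) (succZn n ∣ z ∣)) at-new)
                         (prefixSet-old _ (proj₁ (succZn-range _ n1 v1 vn)) (proj₂ (succZn-range _ n1 v1 vn)))))
                       (cong isNegZ at-new)))
          where
          n1 : 1 ≤ n
          n1 = ≤-trans v1 vn

      repeat-not-perm : ∀ letter w → 1 ≤ ∣ letter ∣ → ∣ letter ∣ ≤ n → members st ∣ letter ∣ ≡ true → isSignedPerm n (q letter w) ≡ false
      repeat-not-perm letter w v1 vn mt with inPrefix-elim p (size st) ∣ letter ∣ (trans (prefixIs _ v1 vn) mt)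
      ... | k , k1 , ks , ek =
        trans (cong (λ z → (length (q letter w) ≡ᵇ n) ∧ z) (trans (cong (λ z → A ∧ z) B) (∧-zeroʳ A))) (∧-zeroʳ _)
        where
        A = all (λ i → (1 ≤ᵇ absAt (q letter w) i) ∧ (absAt (q letter w) i ≤ᵇ n)) (fromTo 1 n)
        B : all (λ i → all (λ j → not (absAt (q letter w) i ≡ᵇ absAt (q letter w) j)) (fromTo (suc i) n)) (fromTo 1 n) ≡ false
        B = all-∈-false _ (fromTo 1 n) (fromTo-∈ k1 (≤-trans ks (<⇒≤ small)))
              (all-∈-false _ (fromTo (suc k) n) (fromTo-∈ (s≤s ks) small)
                 (cong not (≡ᵇ-t (trans (absAt-old letter w k k1 ks) (trans ek (sym (cong ∣_∣ (at-new letter w))))))))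

      arcCond-fails : ∀ letter w → 1 ≤ size st → suc (size st) < n → arcCond n (q letter w) (suc (size st)) ≡ false →
        isSignedArc n (q letter w) ≡ false
      arcCond-fails letter w s1 mid e = all-∈-false _ (fromTo 2 (n ∸ 1)) (fromTo-∈ (s≤s s1) (m+n≤o⇒m≤o∸n (suc (size st)) (subst (_≤ n) (+-comm 1 (suc (size st))) mid))) e

      extend-good : suc (size st) < n → (letter : ℤ) (st' : St) → 1 ≤ ∣ letter ∣ → ∣ letter ∣ ≤ n →
        members st ∣ letter ∣ ≡ false → Transition st ∣ letter ∣ letter st' →
        ((not (members st (predZn n ∣ letter ∣)) ∨ isPosZ letter) ∧ (not (members st (succZn n ∣ letter ∣)) ∨ isNegZ letter)) ≡ true →
        CountInv (p ++ letter ∷ []) st' → Good (p ++ letter ∷ []) st'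
      extend-good mid letter st' v1 vn vf (wf' , sz , J , lastEq) c23 cnt' = record
        { wf = wf'
        ; small = subst (_< n) (sym sz) mid
        ; len = trans (length-++ p) (trans (+-comm (length p) 1) (trans (cong suc len) (sym sz)))
        ; inRange = λ i h1 h2 → rge' i h1 (subst (i ≤_) sz h2)
        ; prefixIs = λ m m1 mn → subst (λ z → inPrefix p' z m ≡ members st' m) (sym sz) (trans (prefixSet-new letter [] m m1 mn) (J m m1 mn))
        ; lastIs = subst (λ z → at p' z ≡ lastLetter st') (sym sz) (trans (at-new letter []) (sym lastEq))
        ; distinct = λ i j h1 h2 h3 → dist' i j h1 h2 (subst (j ≤_) sz h3)
        ; arcOK = λ i h1 h2 → arc' i h1 (subst (i ≤_) sz h2)
        ; countOK = cnt'
        }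
        where
        p' = p ++ letter ∷ []
        v = ∣ letter ∣
        rge' : ∀ i → 1 ≤ i → i ≤ suc (size st) → (1 ≤ absAt p' i) × (absAt p' i ≤ n)
        rge' i h1 h2 with m≤n⇒m<n∨m≡n h2
        ... | inj₁ lt = subst (λ z → (1 ≤ z) × (z ≤ n)) (sym (absAt-old letter [] i h1 (s≤s⁻¹ lt))) (inRange i h1 (s≤s⁻¹ lt))
        ... | inj₂ refl = subst (λ z → (1 ≤ z) × (z ≤ n)) (sym (cong ∣_∣ (at-new letter []))) (v1 , vn)
        dist' : ∀ i j → 1 ≤ i → i < j → j ≤ suc (size st) → absAt p' i ≢ absAt p' j
        dist' i j h1 h2 h3 with m≤n⇒m<n∨m≡n h3
        ... | inj₁ lt = λ e → distinct i j h1 h2 (s≤s⁻¹ lt)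
             (trans (sym (absAt-old letter [] i h1 (≤-trans (<⇒≤ h2) (s≤s⁻¹ lt))))
                    (trans e (absAt-old letter [] j (≤-trans h1 (<⇒≤ h2)) (s≤s⁻¹ lt))))
        ... | inj₂ refl = λ e → false≢true vf (trans (cong (members st) (trans (sym (cong ∣_∣ (at-new letter []))) (sym e)))
                                            (trans (cong (members st) (absAt-old letter [] i h1 (s≤s⁻¹ h2))) (members-prefix G i h1 (s≤s⁻¹ h2))))
        arc' : ∀ i → 2 ≤ i → i ≤ suc (size st) → arcCond n p' i ≡ true
        arc' i h1 h2 with m≤n⇒m<n∨m≡n h2
        ... | inj₁ lt = trans (arcCond-++ p (letter ∷ []) i (≤-trans (s≤s z≤n) h1) (subst (i ≤_) (sym len) (s≤s⁻¹ lt))) (arcOK i h1 (s≤s⁻¹ lt))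
        ... | inj₂ refl = trans (arcCond-new letter [] v1 vn)
              (trans (cong (λ z → z ∧ ((not (members st (predZn n v)) ∨ isPosZ letter) ∧ (not (members st (succZn n v)) ∨ isNegZ letter)))
                     (trans (isInterval-cong n (withValue st v) (members st') J) (members-interval st' wf'))) c23)

    abs-neg : ∀ v → 1 ≤ v → ∣ neg v ∣ ≡ v
    abs-neg (suc v) _ = refl

    isNeg-neg : ∀ v → 1 ≤ v → isNegZ (neg v) ≡ true
    isNeg-neg (suc v) _ = refl

    isPos-neg : ∀ v → isPosZ (neg v) ≡ false
    isPos-neg zero = refl
    isPos-neg (suc v) = refl

    isPos-pos : ∀ v → 1 ≤ v → isPosZ (pos v) ≡ true
    isPos-pos (suc v) _ = refl

    count-snoc : ∀ (p : List ℤ) s → length p ≡ s → ∀ letter b →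
      nsum (fromTo 1 (suc s)) (λ i → ind (b <ᵇ absAt (p ++ letter ∷ []) i)) ≡
      nsum (fromTo 1 s) (λ i → ind (b <ᵇ absAt p i)) + ind (b <ᵇ ∣ letter ∣)
    count-snoc p s len letter b =
      trans (cong (λ l → nsum l (λ i → ind (b <ᵇ absAt (p ++ letter ∷ []) i))) (fromTo-snoc 1 s (s≤s z≤n)))
      (trans (nsum-++ (fromTo 1 s) (suc s ∷ []) _)
      (cong₂ _+_ (nsum-cong (fromTo 1 s) (λ i mm → let (i1 , i2) = fromTo-∈⁻ mm in
                     cong (λ z → ind (b <ᵇ z)) (absAt-++ p (letter ∷ []) i i1 (subst (i ≤_) (sym len) i2))))
                 (trans (+-identityʳ _) (cong (λ z → ind (b <ᵇ ∣ z ∣))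
                   (subst (λ z → at (p ++ letter ∷ []) (suc z) ≡ letter) len (at-snoc p letter []))))))

    count-after-left : ∀ (p : List ℤ) st → length p ≡ size st → WellFormed st → CountInv p st → suc (size st) < n →
      (∀ i → 1 ≤ i → i ≤ size st → members st (absAt p i) ≡ true) →
      CountInv (p ++ neg (leftNbr st) ∷ []) (growLeft st)
    count-after-left p (seg zero s d) len (s1 , _) _ mid' ins =
      trans (cong (λ z → nsum (fromTo 1 z) (λ i → ind (n ∸ 1 <ᵇ absAt (p ++ neg n ∷ []) i))) (+-comm s 1))
      (trans (count-snoc p s len (neg n) (n ∸ 1))
      (cong₂ _+_ (nsum-all0 (fromTo 1 s) _ (λ i mm → let (i1 , i2) = fromTo-∈⁻ mm in
                    <ᵇ-f {n ∸ 1} {absAt p i} (≤-trans (proj₂ (seg-member⇒ {0} {s} {d} (ins i i1 i2)))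
                        (m+n≤o⇒m≤o∸n s (subst (_≤ n) (+-comm 1 s) (<⇒≤ mid'))))))
                 (trans (cong (λ z → ind (n ∸ 1 <ᵇ z)) (abs-neg n n1)) (cong ind (<ᵇ-t {n ∸ 1} {n} (∸-monoʳ-< {n} {1} {0} ≤-refl n1))))))
      where n1 = ≤-trans (s≤s z≤n) (<⇒≤ mid')
    count-after-left p (seg (suc l) s d) _ _ _ _ _ = tt
    count-after-left p (wrap a u d) len (a1 , u1 , h) c mid' ins with wrapData {a} {u} h
    ... | record { c = cc ; e = e ; e2 = e2 ; ac = ac } with cc | e | e2 | ac | wrap-gap-wide {a} {u} {cc} e2 mid'
    ...   | suc c' | e' | e2' | _ | s≤s sa<c' =
      trans (cong (λ z → nsum (fromTo 1 z) (λ i → ind (n ∸ suc u <ᵇ absAt (p ++ neg (n ∸ u) ∷ []) i))) (+-suc a u))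
      (trans (count-snoc p (a + u) len (neg (n ∸ u)) (n ∸ suc u))
      (trans (cong₂ _+_ (trans (nsum-cong (fromTo 1 (a + u)) (λ i mm → let (i1 , i2) = fromTo-∈⁻ mm in cong ind (thr i i1 i2))) c)
                        (trans (cong (λ z → ind (n ∸ suc u <ᵇ z)) (trans (abs-neg (n ∸ u) (subst (1 ≤_) (sym e') (s≤s z≤n))) e'))
                               (cong ind (trans (cong (_<ᵇ suc c') c'eq) (<ᵇ-t {c'} {suc c'} ≤-refl)))))
             (+-comm u 1)))
      where
      c'eq : n ∸ suc u ≡ c'
      c'eq = trans (sym (pred[m∸n]≡m∸[1+n] n u)) (cong Data.Nat.pred e')
      thr : ∀ i → 1 ≤ i → i ≤ a + u → (n ∸ suc u <ᵇ absAt p i) ≡ (n ∸ u <ᵇ absAt p i)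
      thr i i1 i2 with wrap-member⇒ {a} {u} {d} (ins i i1 i2)
      ... | inj₁ q = let q' = subst (λ z → suc z ≤ absAt p i) e' q in
        trans (cong (_<ᵇ absAt p i) c'eq) (trans (<ᵇ-t {c'} {absAt p i} (≤-trans (n≤1+n _) q'))
          (sym (trans (cong (_<ᵇ absAt p i) e') (<ᵇ-t {suc c'} {absAt p i} q'))))
      ... | inj₂ q = trans (cong (_<ᵇ absAt p i) c'eq) (trans (<ᵇ-f {c'} {absAt p i} (≤-trans q (≤-trans (n≤1+n a) sa<c')))
          (sym (trans (cong (_<ᵇ absAt p i) e') (<ᵇ-f {suc c'} {absAt p i} (≤-trans q (≤-trans (n≤1+n a) (≤-trans sa<c' (n≤1+n c'))))))))

    count-after-right : ∀ (p : List ℤ) st → length p ≡ size st → WellFormed st → CountInv p st → suc (size st) < n →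
      (∀ i → 1 ≤ i → i ≤ size st → members st (absAt p i) ≡ true) →
      CountInv (p ++ pos (rightNbr st) ∷ []) (growRight st)
    count-after-right p (seg l s d) len (s1 , ls) _ mid' ins with l + s ≟ n
    ... | no ne rewrite ≡ᵇ-f ne = tt
    ... | yes eq rewrite ≡ᵇ-t eq =
      trans (count-snoc p s len (pos 1) (n ∸ s))
      (trans (cong₂ _+_ (trans (nsum-all1 (fromTo 1 s) _ (λ i mm → let (i1 , i2) = fromTo-∈⁻ mm in
                    <ᵇ-t {n ∸ s} {absAt p i} (subst (λ z → suc z ≤ absAt p i) (sym l≡) (proj₁ (seg-member⇒ {l} {s} {d} (ins i i1 i2))))))
                    (length-fromTo1 s))
                  (cong ind (<ᵇ-f {n ∸ s} {1} (subst (1 ≤_) (sym l≡) (offset-positive l s (<-trans (n<1+n s) mid') eq)))))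
             (+-identityʳ s))
      where
      l≡ : n ∸ s ≡ l
      l≡ = trans (cong (_∸ s) (sym eq)) (m+n∸n≡m l s)
    count-after-right p (wrap a u d) len (a1 , u1 , h) c mid' ins with wrapData {a} {u} h
    ... | record { c = cc ; e = e ; e2 = e2 ; ac = ac } =
      trans (count-snoc p (a + u) len (pos (suc a)) (n ∸ u))
        (trans (cong₂ _+_ c (cong ind (trans (cong (_<ᵇ suc a) e) (<ᵇ-f {cc} {suc a} (<⇒≤ (wrap-gap-wide {a} {u} {cc} e2 mid'))))))
               (+-identityʳ u))

    module _ {p st} (G : Good p st) where
      open Good G
      open GoodProps G

      extend-good-by : suc (size st) < n → (letter : ℤ) (v : ℕ) (st' : St) → ∣ letter ∣ ≡ v → 1 ≤ v → v ≤ n →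
        members st v ≡ false → Transition st v letter st' →
        ((not (members st (predZn n v)) ∨ isPosZ letter) ∧ (not (members st (succZn n v)) ∨ isNegZ letter)) ≡ true →
        CountInv (p ++ letter ∷ []) st' → Good (p ++ letter ∷ []) st'
      extend-good-by mid letter v st' refl = extend-good mid letter st'

      extend-left : suc (size st) < n → Good (p ++ neg (leftNbr st) ∷ []) (growLeft st)
      extend-left mid = extend-good-by mid (neg (leftNbr st)) (leftNbr st) (growLeft st) (abs-neg _ l1) l1 ln (leftNbr-fresh st wf small) (leftNbr-transition st wf mid)
        (∧-true (∨-introˡ (isPosZ (neg (leftNbr st))) (cong not (leftNbr-pred-fresh st wf mid)))
                (∨-introʳ (not (members st (succZn n (leftNbr st)))) (isNeg-neg _ l1)))
        (count-after-left p st len wf countOK mid (members-prefix G))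
        where
        l1 = proj₁ (leftNbr-range st wf small)
        ln = proj₂ (leftNbr-range st wf small)

      extend-right : suc (size st) < n → Good (p ++ pos (rightNbr st) ∷ []) (growRight st)
      extend-right mid = extend-good mid (pos (rightNbr st)) (growRight st) r1 rn (rightNbr-fresh st wf small) (rightNbr-transition st wf mid)
        (∧-true (∨-introʳ (not (members st (predZn n (rightNbr st)))) (isPos-pos _ r1))
                (∨-introˡ (isNegZ (pos (rightNbr st))) (cong not (rightNbr-succ-fresh st wf mid))))
        (count-after-right p st len wf countOK mid (members-prefix G))
        where
        r1 = proj₁ (rightNbr-range st wf small)
        rn = proj₂ (rightNbr-range st wf small)

      other-neg-not-arc : suc (size st) < n → ∀ v → 1 ≤ v → v ≤ n → members st v ≡ false → v ≢ leftNbr st → ∀ w →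
        isSignedArc n (p ++ neg v ∷ w) ≡ false
      other-neg-not-arc mid v v1 vn mf nl w = arcCond-fails (neg v) w (size≥1 st wf) mid
        (trans (arcCond-new (neg v) w (subst (1 ≤_) (sym av) v1) (subst (_≤ n) (sym av) vn))
          (subst (λ z → (isInterval n (withValue st z) ∧ ((not (members st (predZn n z)) ∨ isPosZ (neg v)) ∧
                                              (not (members st (succZn n z)) ∨ isNegZ (neg v)))) ≡ false) (sym av) body))
        where
        av = abs-neg v v1
        body : (isInterval n (withValue st v) ∧ ((not (members st (predZn n v)) ∨ isPosZ (neg v)) ∧
                                          (not (members st (succZn n v)) ∨ isNegZ (neg v)))) ≡ false
        body with v ≟ rightNbr st
        ... | yes refl rewrite rightNbr-pred-member st wf small | isPos-neg (rightNbr st) = trans (cong (isInterval n (withValue st (rightNbr st)) ∧_) refl) (∧-zeroʳ _)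
        ... | no nr rewrite other-letter-breaks-interval st wf mid v v1 vn mf nl nr = refl

      other-pos-not-arc : suc (size st) < n → ∀ v → 1 ≤ v → v ≤ n → members st v ≡ false → v ≢ rightNbr st → ∀ w →
        isSignedArc n (p ++ pos v ∷ w) ≡ false
      other-pos-not-arc mid v v1 vn mf nr w = arcCond-fails (pos v) w (size≥1 st wf) mid (trans (arcCond-new (pos v) w v1 vn) body)
        where
        body : (isInterval n (withValue st v) ∧ ((not (members st (predZn n v)) ∨ isPosZ (pos v)) ∧
                                          (not (members st (succZn n v)) ∨ isNegZ (pos v)))) ≡ false
        body with v ≟ leftNbr st
        ... | yes refl rewrite leftNbr-succ-member st wf small = trans (cong (λ z → isInterval n (withValue st (leftNbr st)) ∧ z) (∧-zeroʳ _)) (∧-zeroʳ _)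
        ... | no nl rewrite other-letter-breaks-interval st wf mid v v1 vn mf nl nr = refl

      last-letter-valid : suc (size st) ≡ n → ∀ letter → ∣ letter ∣ ≡ leftNbr st →
        (isSignedPerm n (p ++ letter ∷ []) ≡ true) × (isSignedArc n (p ++ letter ∷ []) ≡ true)
      last-letter-valid fin letter al = ∧-true (≡ᵇ-t lenq) (∧-true R D) , A
        where
        qq = p ++ letter ∷ []
        lenq : length qq ≡ n
        lenq = trans (length-++ p) (trans (+-comm (length p) 1) (trans (cong suc len) fin))
        lr = leftNbr-range st wf small
        absLast : absAt qq (suc (size st)) ≡ leftNbr st
        absLast = trans (cong ∣_∣ (at-new letter [])) al
        split : ∀ {i} → i ≤ n → (i ≤ size st) ⊎ (i ≡ suc (size st))
        split {i} h with m≤n⇒m<n∨m≡n (subst (i ≤_) (sym fin) h)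
        ... | inj₁ lt = inj₁ (s≤s⁻¹ lt)
        ... | inj₂ eq = inj₂ eq
        R : all (λ i → (1 ≤ᵇ absAt qq i) ∧ (absAt qq i ≤ᵇ n)) (fromTo 1 n) ≡ true
        R = all-∈-true _ (fromTo 1 n) (λ i mm → let (i1 , i2) = fromTo-∈⁻ mm in rr i i1 (split i2))
          where
          rr : ∀ i → 1 ≤ i → (i ≤ size st) ⊎ (i ≡ suc (size st)) → ((1 ≤ᵇ absAt qq i) ∧ (absAt qq i ≤ᵇ n)) ≡ true
          rr i i1 (inj₁ le) rewrite absAt-old letter [] i i1 le = ∧-true (≤ᵇ-t (proj₁ (inRange i i1 le))) (≤ᵇ-t (proj₂ (inRange i i1 le)))
          rr i i1 (inj₂ refl) rewrite absLast = ∧-true (≤ᵇ-t (proj₁ lr)) (≤ᵇ-t (proj₂ lr))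
        -- the values are pairwise distinct: the last one, λ, was fresh
        D : all (λ i → all (λ j → not (absAt qq i ≡ᵇ absAt qq j)) (fromTo (suc i) n)) (fromTo 1 n) ≡ true
        D = all-∈-true _ (fromTo 1 n) (λ i mm → let (i1 , i2) = fromTo-∈⁻ mm in
              all-∈-true _ (fromTo (suc i) n) (λ j mm' → let (j1 , j2) = fromTo-∈⁻ mm' in
                cong not (≡ᵇ-f (dd i j i1 j1 (split j2)))))
          where
          dd : ∀ i j → 1 ≤ i → i < j → (j ≤ size st) ⊎ (j ≡ suc (size st)) → absAt qq i ≢ absAt qq j
          dd i j i1 ij (inj₁ le) e = distinct i j i1 ij le
            (trans (sym (absAt-old letter [] i i1 (≤-trans (<⇒≤ ij) le))) (trans e (absAt-old letter [] j (≤-trans i1 (<⇒≤ ij)) le)))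
          dd i j i1 ij (inj₂ refl) e = false≢true (leftNbr-fresh st wf small)
            (trans (cong (members st) (trans (sym absLast) (sym e)))
              (trans (cong (members st) (absAt-old letter [] i i1 (s≤s⁻¹ ij))) (members-prefix G i i1 (s≤s⁻¹ ij))))
        -- positions 2..n-1 are all inside the good prefix p
        A : isSignedArc n qq ≡ true
        A = all-∈-true _ (fromTo 2 (n ∸ 1)) (λ i mm → let (i1 , i2) = fromTo-∈⁻ mm in
              let i≤s = subst (i ≤_) (trans (cong (_∸ 1) (sym fin)) refl) i2 in
              trans (arcCond-++ p (letter ∷ []) i (≤-trans (s≤s z≤n) i1) (subst (i ≤_) (sym len) i≤s)) (arcOK i i1 i≤s))

    firstLetter : Bool → ℕ → ℤ
    firstLetter true k = pos (suc k)
    firstLetter false k = -[1+ k ]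

    good-first-letter : ∀ k d → 2 ≤ n → k < n → Good (firstLetter d k ∷ []) (seg k 1 d)
    good-first-letter k d n2 kn = record
      { wf = ≤-refl , subst (_≤ n) (+-comm 1 k) kn
      ; small = n2
      ; len = refl
      ; inRange = λ { zero () _ ; (suc zero) _ _ → absr d ; (suc (suc i)) _ (s≤s ()) }
      ; prefixIs = λ m m1 mn → bool-ext (to m) (from m)
      ; lastIs = lst' d
      ; distinct = λ { zero _ () _ _ ; (suc i) zero _ () _ ; (suc i) (suc zero) _ (s≤s ()) _ ; (suc i) (suc (suc j)) _ _ (s≤s ()) }
      ; arcOK = λ { zero () _ ; (suc zero) (s≤s ()) _ ; (suc (suc i)) _ (s≤s ()) }
      ; countOK = tt
      }
      where
      absr : ∀ d → (1 ≤ ∣ firstLetter d k ∣) × (∣ firstLetter d k ∣ ≤ n)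
      absr true = s≤s z≤n , kn
      absr false = s≤s z≤n , kn
      absL : ∀ d → ∣ firstLetter d k ∣ ≡ suc k
      absL true = refl
      absL false = refl
      to : ∀ m → inPrefix (firstLetter d k ∷ []) 1 m ≡ true → members (seg k 1 d) m ≡ true
      to m e with ∨-elim {∣ firstLetter d k ∣ ≡ᵇ m} e
      ... | inj₁ p = let eq = trans (sym (absL d)) (≡ᵇ-sound {∣ firstLetter d k ∣} p) in
          seg-member⇐ {k} {1} {d} {m} (≤-reflexive eq) (subst (m ≤_) (+-comm 1 k) (≤-reflexive (sym eq)))
      to m e | inj₂ ()
      from : ∀ m → members (seg k 1 d) m ≡ true → inPrefix (firstLetter d k ∷ []) 1 m ≡ true
      from m e = let (a , b) = seg-member⇒ {k} {1} {d} {m} e in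
        ∨-introˡ false (≡ᵇ-t {∣ firstLetter d k ∣} (trans (absL d) (≤-antisym a (subst (m ≤_) (+-comm k 1) b))))
      lst' : ∀ d → at (firstLetter d k ∷ []) 1 ≡ lastLetter (seg k 1 d)
      lst' true = cong pos (+-comm 1 k)
      lst' false = refl

  module InversionCount where

    open Ranges
    open import Algebra.Properties.CommutativeSemigroup +-commutativeSemigroup using (interchange)

    nsum-+ : ∀ l (f g : ℕ → ℕ) → nsum l (λ i → f i + g i) ≡ nsum l f + nsum l g
    nsum-+ [] f g = refl
    nsum-+ (x ∷ l) f g rewrite nsum-+ l f g = interchange (f x) (g x) (nsum l f) (nsum l g)

    nsum-snoc : ∀ l x (f : ℕ → ℕ) → nsum (l ++ x ∷ []) f ≡ nsum l f + f x
    nsum-snoc l x f = trans (nsum-++ l (x ∷ []) f) (cong (nsum l f +_) (+-identityʳ (f x)))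

    nsum-triangle-swap : ∀ (c : ℕ → ℕ → Bool) m →
      nsum (fromTo 1 m) (λ i → nsum (fromTo (suc i) m) (λ j → ind (c i j))) ≡
      nsum (fromTo 1 m) (λ j → nsum (fromTo 1 (j ∸ 1)) (λ i → ind (c i j)))
    nsum-triangle-swap c zero = refl
    nsum-triangle-swap c (suc m) =
      begin
        nsum (fromTo 1 (suc m)) (λ i → nsum (fromTo (suc i) (suc m)) (λ j → ind (c i j)))
      ≡⟨ cong (λ l → nsum l (λ i → nsum (fromTo (suc i) (suc m)) (λ j → ind (c i j)))) (fromTo-snoc 1 m (s≤s z≤n)) ⟩
        nsum (fromTo 1 m ++ suc m ∷ []) (λ i → nsum (fromTo (suc i) (suc m)) (λ j → ind (c i j)))
      ≡⟨ nsum-snoc (fromTo 1 m) (suc m) _ ⟩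
        nsum (fromTo 1 m) (λ i → nsum (fromTo (suc i) (suc m)) (λ j → ind (c i j)))
          + nsum (fromTo (suc (suc m)) (suc m)) (λ j → ind (c (suc m) j))
      ≡⟨ cong₂ _+_ (nsum-cong (fromTo 1 m) (λ i mm → let (i1 , i2) = fromTo-∈⁻ mm in
            trans (cong (λ l → nsum l (λ j → ind (c i j))) (fromTo-snoc (suc i) m (s≤s i2)))
                  (nsum-snoc (fromTo (suc i) m) (suc m) (λ j → ind (c i j)))))
          (cong (λ l → nsum l (λ j → ind (c (suc m) j))) (fromTo-nil (suc (suc m)) (suc m) ≤-refl)) ⟩
        nsum (fromTo 1 m) (λ i → nsum (fromTo (suc i) m) (λ j → ind (c i j)) + ind (c i (suc m))) + 0
      ≡⟨ trans (+-identityʳ _) (nsum-+ (fromTo 1 m) _ _) ⟩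
        nsum (fromTo 1 m) (λ i → nsum (fromTo (suc i) m) (λ j → ind (c i j))) + nsum (fromTo 1 m) (λ i → ind (c i (suc m)))
      ≡⟨ cong (_+ nsum (fromTo 1 m) (λ i → ind (c i (suc m)))) (nsum-triangle-swap c m) ⟩
        nsum (fromTo 1 m) (λ j → nsum (fromTo 1 (j ∸ 1)) (λ i → ind (c i j))) + nsum (fromTo 1 m) (λ i → ind (c i (suc m)))
      ≡⟨ sym (trans (cong (λ l → nsum l (λ j → nsum (fromTo 1 (j ∸ 1)) (λ i → ind (c i j)))) (fromTo-snoc 1 m (s≤s z≤n)))
                    (nsum-snoc (fromTo 1 m) (suc m) _)) ⟩
        nsum (fromTo 1 (suc m)) (λ j → nsum (fromTo 1 (j ∸ 1)) (λ i → ind (c i j)))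
      ∎
      where open ≡-Reasoning

    invCount : List _ → ℕ → ℕ
    invCount q s = nsum (fromTo 1 s) (λ j → nsum (fromTo 1 (j ∸ 1)) (λ i → ind (absAt q j <ᵇ absAt q i)))

    invAbs≡invCount : ∀ n q → invAbs n q ≡ invCount q n
    invAbs≡invCount n q = trans (length-concatMap _ (fromTo 1 n))
      (trans (nsum-cong (fromTo 1 n) (λ i _ → length-bfilter _ (fromTo (suc i) n)))
             (nsum-triangle-swap (λ i j → absAt q j <ᵇ absAt q i) n))

module Weighted {c ℓ} (R : CommutativeRing c ℓ) where

  open import Data.Bool using (Bool; true; false; if_then_else_)
  open import Data.Nat using (_<_; _<ᵇ_; z≤n; s≤s)
  import Data.Nat.Properties as NP
  open NP using (≤-refl; ≤-trans; <⇒≢; m≤n⇒m<n∨m≡n; n≤1+n; m≤n⇒m≤1+n; +-suc; m≤m+n; <-irrefl)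
  open import Data.Integer using (ℤ; -[1+_]; ∣_∣) renaming (+_ to pos)
  open import Data.List using (List; []; _∷_; map; _++_; upTo; concatMap; length)
  import Data.List.Properties
  open import Data.List.Properties using (++-assoc)
  open import Data.List.Membership.Propositional using (_∈_)
  open import Data.List.Relation.Unary.Any using (here; there)
  open import Data.Product using (proj₁; proj₂)
  open import Data.Sum using (inj₁; inj₂)
  open import Data.Empty using (⊥-elim)
  open import Relation.Binary.PropositionalEquality as P using (_≡_; _≢_)

  open CommutativeRing R hiding (zero)
  open RingOps R
  open import Relation.Binary.Reasoning.Setoid setoid
  open import Algebra.Properties.CommutativeSemigroup +-commutativeSemigroup using () renaming (interchange to +-interchange)
  open Combinatorics
  open Ranges
  open Windows

  module RingIdentities where

    open import Algebra.Solver.Ring.NaturalCoefficients.Default commutativeSemiring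

    regroup6 : ∀ a1 a2 a3 a4 a5 a6 → (a1 * a2) * (a3 * a4) * (a5 * a6) ≈ a1 * a3 * a5 * (a2 * a4 * a6)
    regroup6 = solve 6 (λ a1 a2 a3 a4 a5 a6 → (a1 :* a2) :* (a3 :* a4) :* (a5 :* a6) := a1 :* a3 :* a5 :* (a2 :* a4 :* a6)) refl

    wrap-step-identity : ∀ A D K Tk P → (A * D) * ((Tk * K) * P) + A * (K * P) ≈ (A * K) * ((1# + Tk * D) * P)
    wrap-step-identity = solve 5 (λ A D K Tk P → (A :* D) :* ((Tk :* K) :* P) :+ A :* (K :* P) := (A :* K) :* ((con 1 :+ Tk :* D) :* P)) refl

    level-first-identity : ∀ HR HL X Y T1 A' → HR * (1# * X * Y * T1 + 1# * 1# * 1# * A') + HL * (1# * 1# * Y * T1 + 1# * 1# * 1# * A')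
            ≈ (HR * X + HL) * Y * T1 + (HR + HL) * A'
    level-first-identity = solve 6 (λ HR HL X Y T1 A' → HR :* (con 1 :* X :* Y :* T1 :+ con 1 :* con 1 :* con 1 :* A') :+ HL :* (con 1 :* con 1 :* Y :* T1 :+ con 1 :* con 1 :* con 1 :* A')
            := (HR :* X :+ HL) :* Y :* T1 :+ (HR :+ HL) :* A') refl

    level-middle-identity : ∀ HR HL F TL TR → HR * (F * TL + 1# * 1# * 1# * TR) + HL * (F * TL + 1# * 1# * 1# * TR)
            ≈ (F * (HR + HL)) * TL + (HR + HL) * TR
    level-middle-identity = solve 5 (λ HR HL F TL TR → HR :* (F :* TL :+ con 1 :* con 1 :* con 1 :* TR) :+ HL :* (F :* TL :+ con 1 :* con 1 :* con 1 :* TR)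
            := (F :* (HR :+ HL)) :* TL :+ (HR :+ HL) :* TR) refl

    level-last-identity : ∀ HR HL F TL S X T2 → HR * (F * TL + S * X * 1# * T2) + HL * (F * TL + S * 1# * 1# * T2)
            ≈ (F * (HR + HL)) * TL + (HR * X + HL) * S * T2
    level-last-identity = solve 7 (λ HR HL F TL S X T2 → HR :* (F :* TL :+ S :* X :* con 1 :* T2) :+ HL :* (F :* TL :+ S :* con 1 :* con 1 :* T2)
            := (F :* (HR :+ HL)) :* TL :+ (HR :* X :+ HL) :* S :* T2) refl

    level-shuffle : ∀ W1 A0 SB SA Bk W2 → (W1 + A0) + ((SB + SA) + (Bk + W2)) ≈ ((A0 + SA) + (SB + Bk)) + (W1 + W2)
    level-shuffle = solve 6 (λ W1 A0 SB SA Bk W2 → (W1 :+ A0) :+ ((SB :+ SA) :+ (Bk :+ W2)) := ((A0 :+ SA) :+ (SB :+ Bk)) :+ (W1 :+ W2)) refl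

    wrap-term-identity : ∀ Qm X D Y Pk S K Pi → (Qm * X + D * Qm) * Y * (Pk * Pi) + (Qm * X + D * Qm) * S * (K * Pi)
              ≈ (X + D) * (S * K + Pk * Y) * Qm * Pi
    wrap-term-identity = solve 8 (λ Qm X D Y Pk S K Pi → (Qm :* X :+ D :* Qm) :* Y :* (Pk :* Pi) :+ (Qm :* X :+ D :* Qm) :* S :* (K :* Pi)
              := (X :+ D) :* (S :* K :+ Pk :* Y) :* Qm :* Pi) refl

    head-step-identity : ∀ Q D → Q + D * Q ≈ Q * (1# + D)
    head-step-identity = solve 2 (λ Q D → Q :+ D :* Q := Q :* (con 1 :+ D)) refl

    unit-weight-neg : ∀ a → 1# * 1# * (a * 1#) ≈ 1# * 1# * a * 1#
    unit-weight-neg = solve 1 (λ a → con 1 :* con 1 :* (a :* con 1) := con 1 :* con 1 :* a :* con 1) refl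

    unit-weight-pos : 1# * 1# * 1# ≈ 1#
    unit-weight-pos = solve 0 (con 1 :* con 1 :* con 1 := con 1) refl

    n1-inversion-identity : ∀ a → 1# * 1# * (a * 1#) + (1# * 1# * 1# + 0#) ≈ (1# + 1# * 1# * a) * 1# + 0#
    n1-inversion-identity = solve 1 (λ a → con 1 :* con 1 :* (a :* con 1) :+ (con 1 :* con 1 :* con 1 :+ con 0) := (con 1 :+ con 1 :* con 1 :* a) :* con 1 :+ con 0) refl

    n1-descent-identity : ∀ a → 1# * (a * 1#) + (1# * 1# + 0#) ≈ ((1# + 1# * a) * 1#) * (1# + 0#)
    n1-descent-identity = solve 1 (λ a → con 1 :* (a :* con 1) :+ (con 1 :* con 1 :+ con 0) := ((con 1 :+ con 1 :* a) :* con 1) :* (con 1 :+ con 0)) refl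

    descent-term-regroup : ∀ L hj hj1 Rr A u v → (L * (hj * (hj1 * Rr))) * (A * (u * v)) ≈ A * L * Rr * ((hj * u) * (hj1 * v))
    descent-term-regroup = solve 7 (λ L hj hj1 Rr A u v → (L :* (hj :* (hj1 :* Rr))) :* (A :* (u :* v)) := A :* L :* Rr :* ((hj :* u) :* (hj1 :* v))) refl

  open RingIdentities

  ≡⇒≈ : ∀ {a b} → a ≡ b → a ≈ b
  ≡⇒≈ P.refl = refl

  sumL-cong : ∀ {A : Set} (l : List A) {f g : A → Carrier} → (∀ a → f a ≈ g a) → sumL l f ≈ sumL l g
  sumL-cong [] h = refl
  sumL-cong (x ∷ l) h = +-cong (h x) (sumL-cong l h)

  sumL-congᵣ : ∀ (l : List ℕ) {f g : ℕ → Carrier} → (∀ a → a ∈ l → f a ≈ g a) → sumL l f ≈ sumL l g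
  sumL-congᵣ [] h = refl
  sumL-congᵣ (x ∷ l) h = +-cong (h x (here P.refl)) (sumL-congᵣ l (λ a m → h a (there m)))

  prodL-congᵣ : ∀ (l : List ℕ) {f g : ℕ → Carrier} → (∀ a → a ∈ l → f a ≈ g a) → prodL l f ≈ prodL l g
  prodL-congᵣ [] h = refl
  prodL-congᵣ (x ∷ l) h = *-cong (h x (here P.refl)) (prodL-congᵣ l (λ a m → h a (there m)))

  sumL-++ : ∀ {A : Set} (l l' : List A) f → sumL (l ++ l') f ≈ sumL l f + sumL l' f
  sumL-++ [] l' f = sym (+-identityˡ _)
  sumL-++ (x ∷ l) l' f = trans (+-cong refl (sumL-++ l l' f)) (sym (+-assoc _ _ _))

  prodL-++ : ∀ {A : Set} (l l' : List A) f → prodL (l ++ l') f ≈ prodL l f * prodL l' f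
  prodL-++ [] l' f = sym (*-identityˡ _)
  prodL-++ (x ∷ l) l' f = trans (*-cong refl (prodL-++ l l' f)) (sym (*-assoc _ _ _))

  sumL-zero : ∀ {A : Set} (l : List A) f → (∀ a → f a ≈ 0#) → sumL l f ≈ 0#
  sumL-zero [] f h = refl
  sumL-zero (x ∷ l) f h = trans (+-cong (h x) (sumL-zero l f h)) (+-identityˡ 0#)

  sumL-bfilter : ∀ {A : Set} (p : A → Bool) (l : List A) f →
    sumL (bfilter p l) f ≈ sumL l (λ a → if p a then f a else 0#)
  sumL-bfilter p [] f = refl
  sumL-bfilter p (x ∷ l) f with p x
  ... | true = +-cong refl (sumL-bfilter p l f)
  ... | false = trans (sumL-bfilter p l f) (sym (+-identityˡ _))

  sumL-map : ∀ {A B : Set} (h : A → B) (l : List A) f → sumL (map h l) f ≡ sumL l (λ a → f (h a))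
  sumL-map h [] f = P.refl
  sumL-map h (x ∷ l) f = P.cong (f (h x) +_) (sumL-map h l f)

  sumL-concatMap : ∀ {A B : Set} (g : A → List B) (l : List A) f →
    sumL (concatMap g l) f ≈ sumL l (λ a → sumL (g a) f)
  sumL-concatMap g [] f = refl
  sumL-concatMap g (x ∷ l) f = trans (sumL-++ (g x) (concatMap g l) f) (+-cong refl (sumL-concatMap g l f))

  pow-+ : ∀ t m k → pow t (m +ℕ k) ≈ pow t m * pow t k
  pow-+ t zero k = sym (*-identityˡ _)
  pow-+ t (suc m) k = trans (*-cong refl (pow-+ t m k)) (sym (*-assoc _ _ _))

  pow-1 : ∀ m → pow 1# m ≈ 1#
  pow-1 zero = refl
  pow-1 (suc m) = trans (*-identityˡ _) (pow-1 m)

  sumL-zeroᵣ : ∀ l (g : ℕ → Carrier) → (∀ i → i ∈ l → g i ≈ 0#) → sumL l g ≈ 0#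
  sumL-zeroᵣ [] g h = refl
  sumL-zeroᵣ (x ∷ l) g h = trans (+-cong (h x (here P.refl)) (sumL-zeroᵣ l g (λ i m → h i (there m)))) (+-identityˡ 0#)

  sumL-rng-point : ∀ a k (g : ℕ → Carrier) c → c ∈ rng a k →
    (∀ i → i ∈ rng a k → i ≢ c → g i ≈ 0#) → sumL (rng a k) g ≈ g c
  sumL-rng-point a (suc k) g .a (here P.refl) h =
    trans (+-cong refl (sumL-zeroᵣ (rng (suc a) k) g (λ i m → h i (there m)
        (λ e → NP.<⇒≢ (proj₁ (rng-∈⁻ (suc a) k i m)) (P.sym e))))) (+-identityʳ _)
  sumL-rng-point a (suc k) g c (there m) h =
    trans (+-cong (h a (here P.refl) (NP.<⇒≢ (proj₁ (rng-∈⁻ (suc a) k c m))))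
                  (sumL-rng-point (suc a) k g c m (λ i m' → h i (there m')))) (+-identityˡ _)

  upTo-rng : ∀ n → upTo n ≡ rng 0 n
  upTo-rng n = applyUpTo-rng 0 n

  sumL-upTo-point : ∀ n (g : ℕ → Carrier) c → c < n → (∀ i → i < n → i ≢ c → g i ≈ 0#) → sumL (upTo n) g ≈ g c
  sumL-upTo-point n g c c<n h rewrite upTo-rng n =
    sumL-rng-point 0 n g c (rng-∈ 0 n c z≤n c<n) (λ i m → h i (proj₂ (rng-∈⁻ 0 n i m)))

  signedVals-split : ∀ n (h : ℤ → Carrier) →
    sumL (signedVals n) h ≈ sumL (upTo n) (λ k → h -[1+ k ]) + sumL (upTo n) (λ k → h (pos (suc k)))
  signedVals-split n h = trans (sumL-++ (map -[1+_] (upTo n)) (map (λ k → pos (suc k)) (upTo n)) h)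
    (+-cong (≡⇒≈ (sumL-map -[1+_] (upTo n) h)) (≡⇒≈ (sumL-map (λ k → pos (suc k)) (upTo n) h)))

  signedVals-two-point : ∀ n (h : ℤ → Carrier) c d → 1 ≤ c → c ≤ n → 1 ≤ d → d ≤ n →
    (∀ v → 1 ≤ v → v ≤ n → (v ≢ c → h (neg v) ≈ 0#) × (v ≢ d → h (pos v) ≈ 0#)) →
    sumL (signedVals n) h ≈ h (neg c) + h (pos d)
  signedVals-two-point n h (suc c) (suc d) (s≤s _) c≤n (s≤s _) d≤n H = trans (signedVals-split n h)
    (+-cong (sumL-upTo-point n (λ k → h -[1+ k ]) c c≤n
               (λ i i<n i≢c → proj₁ (H (suc i) (s≤s z≤n) i<n) (λ e → i≢c (NP.suc-injective e))))
            (sumL-upTo-point n (λ k → h (pos (suc k))) d d≤n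
               (λ i i<n i≢d → proj₂ (H (suc i) (s≤s z≤n) i<n) (λ e → i≢d (NP.suc-injective e)))))

  sumL-+ : ∀ {A : Set} (l : List A) f g → sumL l (λ a → f a + g a) ≈ sumL l f + sumL l g
  sumL-+ [] f g = sym (+-identityˡ 0#)
  sumL-+ (z ∷ l) f g = trans (+-cong refl (sumL-+ l f g)) (+-interchange (f z) (g z) (sumL l f) (sumL l g))

  sumL-upTo-cons : ∀ k (f : ℕ → Carrier) → sumL (upTo (suc k)) f ≈ f 0 + sumL (upTo k) (λ i → f (suc i))
  sumL-upTo-cons k f = +-cong refl (trans (≡⇒≈ (P.cong (λ l → sumL l f) (P.sym (Data.List.Properties.map-upTo suc k))))
                                          (≡⇒≈ (sumL-map suc (upTo k) f)))

  sumL-upTo-snoc : ∀ k (f : ℕ → Carrier) → sumL (upTo (suc k)) f ≈ sumL (upTo k) f + f k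
  sumL-upTo-snoc k f = trans (≡⇒≈ (P.cong (λ l → sumL l f) (P.sym (Data.List.Properties.upTo-∷ʳ k))))
    (trans (sumL-++ (upTo k) (k ∷ []) f) (+-cong refl (+-identityʳ (f k))))

  sumL-congᵤ : ∀ k {f g : ℕ → Carrier} → (∀ i → i < k → f i ≈ g i) → sumL (upTo k) f ≈ sumL (upTo k) g
  sumL-congᵤ k h rewrite upTo-rng k = sumL-congᵣ (rng 0 k) (λ i m → h i (proj₂ (rng-∈⁻ 0 k i m)))

  prodL-fromTo-cons : ∀ a b (f : ℕ → Carrier) → a ≤ b → prodL (fromTo a b) f ≈ f a * prodL (fromTo (suc a) b) f
  prodL-fromTo-cons a b f h = ≡⇒≈ (P.cong (λ l → prodL l f) (fromTo-cons a b h))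

  prodL-fromTo-snoc : ∀ a b (f : ℕ → Carrier) → a ≤ suc b → prodL (fromTo a (suc b)) f ≈ prodL (fromTo a b) f * f (suc b)
  prodL-fromTo-snoc a b f h = trans (≡⇒≈ (P.cong (λ l → prodL l f) (fromTo-snoc a b h)))
    (trans (prodL-++ (fromTo a b) (suc b ∷ []) f) (*-cong refl (*-identityʳ (f (suc b)))))

  sumL-fromTo-cons : ∀ a b (f : ℕ → Carrier) → a ≤ b → sumL (fromTo a b) f ≈ f a + sumL (fromTo (suc a) b) f
  sumL-fromTo-cons a b f h = ≡⇒≈ (P.cong (λ l → sumL l f) (fromTo-cons a b h))

  sumL-*ˡ : ∀ {A : Set} (l : List A) a f → a * sumL l f ≈ sumL l (λ z → a * f z)
  sumL-*ˡ [] a f = zeroʳ a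
  sumL-*ˡ (z ∷ l) a f = trans (distribˡ a (f z) (sumL l f)) (+-cong refl (sumL-*ˡ l a f))

  prodR-split : ∀ a b c (f : ℕ → Carrier) → a ≤ suc b → b ≤ c → prodR a c f ≈ prodR a b f * prodR (suc b) c f
  prodR-split a b c f ab bc with m≤n⇒m<n∨m≡n bc
  ... | inj₂ P.refl = trans (sym (*-identityʳ _)) (*-cong refl (≡⇒≈ (P.cong (λ l → prodL l f) (P.sym (fromTo-nil (suc b) b ≤-refl)))))
  prodR-split a b (suc c) f ab bc | inj₁ (s≤s b≤c) = begin
    prodR a (suc c) f ≈⟨ prodL-fromTo-snoc a c f (≤-trans ab (s≤s b≤c)) ⟩
    prodR a c f * f (suc c) ≈⟨ *-cong (prodR-split a b c f ab b≤c) refl ⟩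
    (prodR a b f * prodR (suc b) c f) * f (suc c) ≈⟨ *-assoc _ _ _ ⟩
    prodR a b f * (prodR (suc b) c f * f (suc c)) ≈⟨ *-cong refl (sym (prodL-fromTo-snoc (suc b) c f (s≤s b≤c))) ⟩
    prodR a b f * prodR (suc b) (suc c) f ∎

  module Weights (n : ℕ) (t : Carrier) (x y : ℕ → Carrier) where

    open InversionCount

    weight : List ℤ → ℕ → Carrier
    weight q s = pow t (invCount q s) * mono x (Des s q) * mono y (Neg s q)

    stepFactor : ℕ → ℕ → Bool → Bool → Carrier
    stepFactor s e cc ng = pow t e * (if cc then x s else 1#) * (if ng then y (suc s) else 1#)

    arcWeight : List ℤ → Carrier
    arcWeight q = pow t (invAbs n q) * mono x (Des n q) * mono y (Neg n q)

    arcWeight≈weight : ∀ q → arcWeight q ≈ weight q n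
    arcWeight≈weight q = ≡⇒≈ (P.cong (λ z → pow t z * mono x (Des n q) * mono y (Neg n q)) (invAbs≡invCount n q))

    prod-single : ∀ (f : ℕ → Carrier) (b : Bool) k → prodL (if b then k ∷ [] else []) f ≈ (if b then f k else 1#)
    prod-single f true k = *-identityʳ (f k)
    prod-single f false k = refl

    des-snoc : ∀ (p : List ℤ) (a : ℤ) s → length p ≡ s → 1 ≤ s → Des (suc s) (p ++ a ∷ []) ≡ Des s p ++ (if (a <B at p s) then s ∷ [] else [])
    des-snoc p a s len s1 with s | len | s1
    ... | suc s' | len' | _ =
      P.trans (P.cong (bfilter (λ i → at (p ++ a ∷ []) (suc i) <B at (p ++ a ∷ []) i)) (fromTo-snoc 1 s' (s≤s z≤n)))
      (P.trans (bfilter-++ _ (fromTo 1 s') (suc s' ∷ []))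
        (P.cong₂ _++_ (bfilter-cong (fromTo 1 s') (λ i mm → let (i1 , i2) = fromTo-∈⁻ mm in
                         P.cong₂ _<B_ (at-++ p (a ∷ []) (suc i) (s≤s z≤n) (P.subst (suc i ≤_) (P.sym len') (s≤s i2)))
                                      (at-++ p (a ∷ []) i i1 (P.subst (i ≤_) (P.sym len') (m≤n⇒m≤1+n i2)))))
                      (P.cong₂ (λ u v → if (u <B v) then suc s' ∷ [] else [])
                         (P.subst (λ z → at (p ++ a ∷ []) (suc z) ≡ a) len' (at-snoc p a []))
                         (at-++ p (a ∷ []) (suc s') (s≤s z≤n) (P.subst (suc s' ≤_) (P.sym len') ≤-refl)))))

    module _ (p : List ℤ) (a : ℤ) (s : ℕ) (len : length p ≡ s) where
      p' : List ℤ
      p' = p ++ a ∷ []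

      absp : ∀ i → 1 ≤ i → i ≤ s → absAt p' i ≡ absAt p i
      absp i h1 h2 = absAt-++ p (a ∷ []) i h1 (P.subst (i ≤_) (P.sym len) h2)

      atp : ∀ i → 1 ≤ i → i ≤ s → at p' i ≡ at p i
      atp i h1 h2 = at-++ p (a ∷ []) i h1 (P.subst (i ≤_) (P.sym len) h2)

      atl : at p' (suc s) ≡ a
      atl = P.subst (λ z → at p' (suc z) ≡ a) len (at-snoc p a [])

      newInversions : ℕ
      newInversions = nsum (fromTo 1 s) (λ i → ind (∣ a ∣ <ᵇ absAt p i))

      inv-snoc : invCount p' (suc s) ≡ invCount p s +ℕ newInversions
      inv-snoc = P.trans (P.cong (λ l → nsum l G') (fromTo-snoc 1 s (s≤s z≤n)))
        (P.trans (nsum-snoc (fromTo 1 s) (suc s) G')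
          (P.cong₂ _+ℕ_
            (nsum-cong (fromTo 1 s) (λ j mm → let (j1 , j2) = fromTo-∈⁻ mm in
               nsum-cong (fromTo 1 (j ∸ 1)) (λ i mm' → let (i1 , i2) = fromTo-∈⁻ mm' in
                 P.cong₂ (λ u v → ind (u <ᵇ v)) (absp j j1 j2)
                   (absp i i1 (≤-trans i2 (≤-trans (NP.m∸n≤m j 1) j2))))))
            (nsum-cong (fromTo 1 s) (λ i mm → let (i1 , i2) = fromTo-∈⁻ mm in
               P.cong₂ (λ u v → ind (u <ᵇ v)) (P.cong ∣_∣ atl) (absp i i1 i2)))))
        where
        G' = λ j → nsum (fromTo 1 (j ∸ 1)) (λ i → ind (absAt p' j <ᵇ absAt p' i))

      neg-snoc : Neg (suc s) p' ≡ Neg s p ++ (if isNegZ a then suc s ∷ [] else [])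
      neg-snoc = P.trans (P.cong (bfilter (λ i → isNegZ (at p' i))) (fromTo-snoc 1 s (s≤s z≤n)))
        (P.trans (bfilter-++ _ (fromTo 1 s) (suc s ∷ []))
          (P.cong₂ _++_ (bfilter-cong (fromTo 1 s) (λ i mm → let (i1 , i2) = fromTo-∈⁻ mm in P.cong isNegZ (atp i i1 i2)))
                        (P.cong (λ z → if isNegZ z then suc s ∷ [] else []) atl)))

      weight-snoc : 1 ≤ s → weight p' (suc s) ≈ weight p s * stepFactor s newInversions (a <B at p s) (isNegZ a)
      weight-snoc s1 = begin
        pow t (invCount p' (suc s)) * mono x (Des (suc s) p') * mono y (Neg (suc s) p')
          ≈⟨ *-cong (*-cong (≡⇒≈ (P.cong (pow t) inv-snoc)) (≡⇒≈ (P.cong (mono x) (des-snoc p a s len s1)))) (≡⇒≈ (P.cong (mono y) neg-snoc)) ⟩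
        pow t (invCount p s +ℕ newInversions) * mono x (Des s p ++ (if (a <B at p s) then s ∷ [] else []))
          * mono y (Neg s p ++ (if isNegZ a then suc s ∷ [] else []))
          ≈⟨ *-cong (*-cong (pow-+ t (invCount p s) newInversions) (prodL-++ (Des s p) _ x)) (prodL-++ (Neg s p) _ y) ⟩
        (pow t (invCount p s) * pow t newInversions) * (mono x (Des s p) * prodL (if (a <B at p s) then s ∷ [] else []) x)
          * (mono y (Neg s p) * prodL (if isNegZ a then suc s ∷ [] else []) y)
          ≈⟨ *-cong (*-cong refl (*-cong refl (prod-single x (a <B at p s) s))) (*-cong refl (prod-single y (isNegZ a) (suc s))) ⟩
        (pow t (invCount p s) * pow t newInversions) * (mono x (Des s p) * (if (a <B at p s) then x s else 1#))
          * (mono y (Neg s p) * (if isNegZ a then y (suc s) else 1#))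
          ≈⟨ regroup6 _ _ _ _ _ _ ⟩
        pow t (invCount p s) * mono x (Des s p) * mono y (Neg s p) * (pow t newInversions * (if (a <B at p s) then x s else 1#) * (if isNegZ a then y (suc s) else 1#))
        ∎

  module TransferSum (n : ℕ) (t : Carrier) (x y : ℕ → Carrier) where

    open States n
    open GoodPrefixes n
    open Weights n t x y

    -- The transfer polynomial: weighted sum over all ways to complete a prefix in state st
    -- with k more letters, following the two admissible transitions.
    transfer : St → ℕ → Carrier
    transfer st zero = 1#
    transfer st (suc k) =
      stepFactor (size st) (invLeft st) (desLeft st) true * transfer (growLeft st) k
      + stepFactor (size st) (invRight st) (desRight st) false * transfer (growRight st) k

    -- The summand of the theorem extended by 0 to all words.
    filtered : List ℤ → Carrier
    filtered q = if isSignedPerm n q then (if isSignedArc n q then arcWeight q else 0#) else 0#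

    filtered-nonperm : ∀ q → isSignedPerm n q ≡ false → filtered q ≈ 0#
    filtered-nonperm q e rewrite e = refl

    filtered-nonarc : ∀ q → isSignedArc n q ≡ false → filtered q ≈ 0#
    filtered-nonarc q e with isSignedPerm n q
    ... | false = refl
    ... | true rewrite e = refl

    filtered-valid : ∀ q → isSignedPerm n q ≡ true → isSignedArc n q ≡ true → filtered q ≈ arcWeight q
    filtered-valid q e1 e2 rewrite e1 | e2 = refl

    sv : List ℤ
    sv = signedVals n

    words-step : ∀ k (g : List ℤ → Carrier) → sumL (words (suc k) sv) g ≈ sumL sv (λ a → sumL (words k sv) (λ w → g (a ∷ w)))
    words-step k g = trans (sumL-concatMap (λ a → map (a ∷_) (words k sv)) sv g)
      (sumL-cong sv (λ a → ≡⇒≈ (sumL-map (a ∷_) (words k sv) g)))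

    branchSum : ℕ → List ℤ → ℤ → Carrier
    branchSum k p a = sumL (words k sv) (λ w → filtered (p ++ a ∷ w))

    two-branches : ∀ k p st (G : Good p st) →
      (∀ v → 1 ≤ v → v ≤ n → (v ≢ leftNbr st → branchSum k p (neg v) ≈ 0#) × (v ≢ rightNbr st → branchSum k p (pos v) ≈ 0#)) →
      sumL (words (suc k) sv) (λ w → filtered (p ++ w)) ≈ branchSum k p (neg (leftNbr st)) + branchSum k p (pos (rightNbr st))
    two-branches k p st G van = trans (words-step k (λ w → filtered (p ++ w)))
      (signedVals-two-point n (branchSum k p) (leftNbr st) (rightNbr st) (proj₁ lr) (proj₂ lr) (proj₁ rr) (proj₂ rr) van)
      where
      open Good G
      lr = leftNbr-range st wf small
      rr = rightNbr-range st wf small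

    module Step {p st} (G : Good p st) where
      open Good G
      open GoodProps G

      step-weight : ∀ letter v E D ng → ∣ letter ∣ ≡ v → exceedCount G v ≡ E → (letter <B lastLetter st) ≡ D → isNegZ letter ≡ ng →
        weight (p ++ letter ∷ []) (suc (size st)) ≈ weight p (size st) * stepFactor (size st) E D ng
      step-weight letter v E D ng av ec ed en =
        trans (weight-snoc p letter (size st) len (size≥1 st wf))
          (*-cong refl (≡⇒≈ (P.trans (P.cong₂ (λ u w → stepFactor (size st) u w (isNegZ letter))
               (P.trans (P.cong (λ z → nsum (fromTo 1 (size st)) (λ i → ind (z <ᵇ absAt p i))) av) ec)
               (P.trans (P.cong (letter <B_) lastIs) ed))
             (P.cong (stepFactor (size st) E D) en))))

      step-weight-left : weight (p ++ neg (leftNbr st) ∷ []) (suc (size st)) ≈ weight p (size st) * stepFactor (size st) (invLeft st) (desLeft st) true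
      step-weight-left = step-weight (neg (leftNbr st)) (leftNbr st) (invLeft st) (desLeft st) true (abs-neg _ (proj₁ (leftNbr-range st wf small))) exceedCount-left
                (leftNbr-descent st wf small) (isNeg-neg _ (proj₁ (leftNbr-range st wf small)))

      step-weight-right : weight (p ++ pos (rightNbr st) ∷ []) (suc (size st)) ≈ weight p (size st) * stepFactor (size st) (invRight st) (desRight st) false
      step-weight-right = step-weight (pos (rightNbr st)) (rightNbr st) (invRight st) (desRight st) false P.refl exceedCount-right (rightNbr-descent st wf small) P.refl

      repeated-branch-vanishes : ∀ k v → 1 ≤ v → v ≤ n → members st v ≡ true → (branchSum k p (neg v) ≈ 0#) × (branchSum k p (pos v) ≈ 0#)
      repeated-branch-vanishes k v v1 vn mt =
        sumL-zero (words k sv) (λ w → filtered (p ++ neg v ∷ w)) (λ w → filtered-nonperm (p ++ neg v ∷ w) (repeat-not-perm (neg v) w (P.subst (1 ≤_) (P.sym av) v1) (P.subst (_≤ n) (P.sym av) vn)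
                                           (P.trans (P.cong (members st) av) mt))) ,
        sumL-zero (words k sv) (λ w → filtered (p ++ pos v ∷ w)) (λ w → filtered-nonperm (p ++ pos v ∷ w) (repeat-not-perm (pos v) w v1 vn mt))
        where av = abs-neg v v1

    not-last-step : ∀ s k → s +ℕ suc (suc k) ≡ n → suc s < n
    not-last-step s k e = P.subst (suc (suc s) ≤_) e (P.subst (suc (suc s) ≤_) (P.sym (P.trans (+-suc s (suc k)) (P.cong suc (+-suc s k))))
                     (s≤s (s≤s (m≤m+n s k))))

    module Branches {p st} (G : Good p st) where
      open Good G
      open Step G

      -- Last position: the only fresh value is λ = ρ, and both signed letters ±λ complete
      -- p to a signed arc permutation; this is `transfer st 1`.
      last-step-sum : suc (size st) ≡ n →
        sumL (words 1 sv) (λ w → filtered (p ++ w)) ≈ weight p (size st) * transfer st 1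
      last-step-sum fin = trans (two-branches zero p st G van) (trans (+-cong hL hR) (sym (distribˡ _ _ _)))
        where
        s = size st
        forced = last-letter-forced st wf fin
        van : ∀ v → 1 ≤ v → v ≤ n → (v ≢ leftNbr st → branchSum zero p (neg v) ≈ 0#) × (v ≢ rightNbr st → branchSum zero p (pos v) ≈ 0#)
        van v v1 vn with members st v in eqm
        ... | true = (λ _ → proj₁ (repeated-branch-vanishes zero v v1 vn eqm)) , (λ _ → proj₂ (repeated-branch-vanishes zero v v1 vn eqm))
        ... | false = (λ ne → ⊥-elim (ne (proj₂ forced v v1 vn eqm))) , (λ ne → ⊥-elim (ne (P.trans (proj₂ forced v v1 vn eqm) (proj₁ forced))))
        complete : ∀ letter → ∣ letter ∣ ≡ leftNbr st → filtered (p ++ letter ∷ []) ≈ weight (p ++ letter ∷ []) (suc s)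
        complete letter al = let (v1 , v2) = last-letter-valid G fin letter al in
          trans (filtered-valid (p ++ letter ∷ []) v1 v2) (trans (arcWeight≈weight (p ++ letter ∷ [])) (≡⇒≈ (P.cong (weight (p ++ letter ∷ [])) (P.sym fin))))
        hL : branchSum zero p (neg (leftNbr st)) ≈ weight p s * (stepFactor s (invLeft st) (desLeft st) true * 1#)
        hL = trans (+-identityʳ _) (trans (complete (neg (leftNbr st)) (abs-neg _ (proj₁ (leftNbr-range st wf small))))
                   (trans step-weight-left (*-cong refl (sym (*-identityʳ _)))))
        hR : branchSum zero p (pos (rightNbr st)) ≈ weight p s * (stepFactor s (invRight st) (desRight st) false * 1#)
        hR = trans (+-identityʳ _) (trans (complete (pos (rightNbr st)) (P.sym (proj₁ forced)))
                   (trans step-weight-right (*-cong refl (sym (*-identityʳ _)))))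

      -- Middle position: every branch other than -λ and +ρ contributes 0, either because
      -- the value repeats or because the arc condition fails at the new position.
      middle-branches-vanish : suc (size st) < n → ∀ k v → 1 ≤ v → v ≤ n →
        (v ≢ leftNbr st → branchSum k p (neg v) ≈ 0#) × (v ≢ rightNbr st → branchSum k p (pos v) ≈ 0#)
      middle-branches-vanish mid k v v1 vn with members st v in eqm
      ... | true = (λ _ → proj₁ (repeated-branch-vanishes k v v1 vn eqm)) , (λ _ → proj₂ (repeated-branch-vanishes k v v1 vn eqm))
      ... | false = (λ ne → sumL-zero (words k sv) (λ w → filtered (p ++ neg v ∷ w)) (λ w → filtered-nonarc (p ++ neg v ∷ w) (other-neg-not-arc G mid v v1 vn eqm ne w))) ,
                    (λ ne → sumL-zero (words k sv) (λ w → filtered (p ++ pos v ∷ w)) (λ w → filtered-nonarc (p ++ pos v ∷ w) (other-pos-not-arc G mid v v1 vn eqm ne w)))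

      branch-factor : ∀ k letter st' F → size st' ≡ suc (size st) →
        sumL (words (suc k) sv) (λ w → filtered ((p ++ letter ∷ []) ++ w)) ≈ weight (p ++ letter ∷ []) (size st') * transfer st' (suc k) →
        weight (p ++ letter ∷ []) (suc (size st)) ≈ weight p (size st) * F →
        branchSum (suc k) p letter ≈ weight p (size st) * (F * transfer st' (suc k))
      branch-factor k letter st' F sz ext sw =
        trans (sumL-cong (words (suc k) sv) (λ w → ≡⇒≈ (P.cong filtered (P.sym (++-assoc p (letter ∷ []) w)))))
        (trans ext
        (trans (*-cong (≡⇒≈ (P.cong (weight (p ++ letter ∷ [])) sz)) refl)
        (trans (*-cong sw refl) (*-assoc _ _ _))))

    extension-sum : ∀ k p st → Good p st → size st +ℕ suc k ≡ n →
      sumL (words (suc k) sv) (λ w → filtered (p ++ w)) ≈ weight p (size st) * transfer st (suc k)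
    extension-sum zero p st G e = Branches.last-step-sum G (P.trans (NP.+-comm 1 (size st)) e)
    extension-sum (suc k) p st G e =
      trans (two-branches (suc k) p st G (middle-branches-vanish mid (suc k)))
        (trans (+-cong (branch-factor k (neg (leftNbr st)) (growLeft st) _ sizeL
                          (extension-sum k _ (growLeft st) (extend-left G mid) (remaining {growLeft st} sizeL))
                          step-weight-left)
                       (branch-factor k (pos (rightNbr st)) (growRight st) _ sizeR
                          (extension-sum k _ (growRight st) (extend-right G mid) (remaining {growRight st} sizeR))
                          step-weight-right))
               (sym (distribˡ _ _ _)))
      where
      open Good G
      open Step G
      open Branches G
      mid : suc (size st) < n
      mid = not-last-step (size st) k e
      sizeL = proj₁ (proj₂ (leftNbr-transition st wf mid))
      sizeR = proj₁ (proj₂ (rightNbr-transition st wf mid))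
      remaining : ∀ {st'} → size st' ≡ suc (size st) → size st' +ℕ suc k ≡ n
      remaining sz = P.trans (P.cong (_+ℕ suc k) sz) (P.trans (P.sym (+-suc (size st) (suc k))) e)

    sum-by-first-letter : ∀ m → n ≡ suc (suc m) →
      sumL (SignedArc n) arcWeight ≈ sumL (upTo n) (λ k → weight (firstLetter false k ∷ []) 1 * transfer (seg k 1 false) (suc m))
                            + sumL (upTo n) (λ k → weight (firstLetter true k ∷ []) 1 * transfer (seg k 1 true) (suc m))
    sum-by-first-letter m eq = begin
      sumL (bfilter (isSignedArc n) (bfilter (isSignedPerm n) (words n sv))) arcWeight
        ≈⟨ sumL-bfilter (isSignedArc n) (bfilter (isSignedPerm n) (words n sv)) arcWeight ⟩
      sumL (bfilter (isSignedPerm n) (words n sv)) (λ q → if isSignedArc n q then arcWeight q else 0#)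
        ≈⟨ sumL-bfilter (isSignedPerm n) (words n sv) _ ⟩
      sumL (words n sv) filtered
        ≡⟨ P.cong (λ z → sumL (words z sv) filtered) eq ⟩
      sumL (words (suc (suc m)) sv) filtered
        ≈⟨ words-step (suc m) filtered ⟩
      sumL sv (λ a → sumL (words (suc m) sv) (λ w → filtered (a ∷ w)))
        ≈⟨ signedVals-split n _ ⟩
      sumL (upTo n) (λ k → sumL (words (suc m) sv) (λ w → filtered (-[1+ k ] ∷ w)))
        + sumL (upTo n) (λ k → sumL (words (suc m) sv) (λ w → filtered (pos (suc k) ∷ w)))
        ≈⟨ +-cong (sumL-congᵤ n (λ k k<n → extension-sum m (firstLetter false k ∷ []) (seg k 1 false) (good-first-letter k false n2 k<n) (P.sym eq)))
                  (sumL-congᵤ n (λ k k<n → extension-sum m (firstLetter true k ∷ []) (seg k 1 true) (good-first-letter k true n2 k<n) (P.sym eq))) ⟩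
      sumL (upTo n) (λ k → weight (firstLetter false k ∷ []) 1 * transfer (seg k 1 false) (suc m))
        + sumL (upTo n) (λ k → weight (firstLetter true k ∷ []) 1 * transfer (seg k 1 true) (suc m)) ∎
      where
      n2 : 2 ≤ n
      n2 = P.subst (2 ≤_) (P.sym eq) (s≤s (s≤s z≤n))

  module InversionFormula (n : ℕ) (t : Carrier) (x₀ y : ℕ → Carrier) where

    open States n

    x : ℕ → Carrier
    x = withX0 x₀

    open Weights n t x y
    open TransferSum n t x y using (transfer; sum-by-first-letter)
    open GoodPrefixes n using (firstLetter)

    headFactor : ℕ → Carrier
    headFactor i = 1# + pow t (i ∸ 1) * x (i ∸ 1) * y i

    tailFactor : ℕ → Carrier
    tailFactor i = 1# + pow t (n ∸ i) * x (i ∸ 1) * y i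

    -- Closed form for wrapped states: from a wrapped state with a + u + k = n every completion
    -- has the same inversions, and the choices at each step multiply.
    transfer-wrap : ∀ k a u d → a +ℕ u +ℕ k ≡ n → transfer (wrap a u d) k ≈ pow t (k *ℕ u) * prodR (suc (a +ℕ u)) n tailFactor
    transfer-wrap zero a u d e = begin
      1# ≈⟨ sym (*-identityˡ 1#) ⟩
      1# * 1# ≈⟨ *-cong refl (≡⇒≈ (P.cong (λ l → prodL l tailFactor) (P.sym (fromTo-nil (suc (a +ℕ u)) n
                     (P.subst (_< suc (a +ℕ u)) (P.trans (P.sym (NP.+-identityʳ _)) e) NP.≤-refl))))) ⟩
      1# * prodR (suc (a +ℕ u)) n tailFactor ∎
    transfer-wrap (suc k) a u d e = begin
      stepFactor s u true true * transfer (wrap a (suc u) false) k + stepFactor s u false false * transfer (wrap (suc a) u true) k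
        ≈⟨ +-cong (*-cong refl (transfer-wrap k a (suc u) false e1)) (*-cong refl (transfer-wrap k (suc a) u true e2)) ⟩
      stepFactor s u true true * (pow t (k *ℕ suc u) * prodR (suc (a +ℕ suc u)) n tailFactor)
        + stepFactor s u false false * (pow t (k *ℕ u) * prodR (suc (suc a +ℕ u)) n tailFactor)
        ≈⟨ +-cong (*-cong (*-assoc _ _ _) (*-cong (trans (≡⇒≈ (P.cong (pow t) (NP.*-suc k u))) (pow-+ t k (k *ℕ u)))
                                                   (≡⇒≈ (P.cong (λ z → prodR (suc z) n tailFactor) (NP.+-suc a u)))))
                  (*-cong (trans (*-identityʳ _) (*-identityʳ _)) refl) ⟩
      (pow t u * (x s * y (suc s))) * ((pow t k * pow t (k *ℕ u)) * prodR (suc (suc s)) n tailFactor)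
        + pow t u * (pow t (k *ℕ u) * prodR (suc (suc s)) n tailFactor)
        ≈⟨ wrap-step-identity (pow t u) (x s * y (suc s)) (pow t (k *ℕ u)) (pow t k) (prodR (suc (suc s)) n tailFactor) ⟩
      (pow t u * pow t (k *ℕ u)) * ((1# + pow t k * (x s * y (suc s))) * prodR (suc (suc s)) n tailFactor)
        ≈⟨ *-cong (sym (pow-+ t u (k *ℕ u))) (*-cong (+-cong refl (trans (sym (*-assoc _ _ _)) (*-cong (*-cong (≡⇒≈ (P.cong (pow t) (P.sym nk))) refl) refl))) refl) ⟩
      pow t (suc k *ℕ u) * (tailFactor (suc s) * prodR (suc (suc s)) n tailFactor)
        ≈⟨ *-cong refl (sym (prodL-fromTo-cons (suc s) n tailFactor sn)) ⟩
      pow t (suc k *ℕ u) * prodR (suc s) n tailFactor ∎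
      where
      s = a +ℕ u
      e1 : a +ℕ suc u +ℕ k ≡ n
      e1 = P.trans (P.cong (_+ℕ k) (NP.+-suc a u)) (P.trans (P.sym (NP.+-suc s k)) e)
      e2 : suc a +ℕ u +ℕ k ≡ n
      e2 = P.trans (P.sym (NP.+-suc s k)) e
      nk : n ∸ suc s ≡ k
      nk = P.trans (P.cong (_∸ suc s) (P.sym e)) (P.trans (P.cong (_∸ suc s) (NP.+-suc s k)) (NP.m+n∸m≡n (suc s) k))
      sn : suc s ≤ n
      sn = P.subst (suc s ≤_) e (P.subst (_≤ s +ℕ suc k) P.refl (P.subst (suc s ≤_) (P.sym (NP.+-suc s k)) (s≤s (NP.m≤m+n s k))))

    headProduct : ℕ → Carrier
    headProduct s = prodR 1 s headFactor

    -- The coefficients of the segment states at level s, i.e. the total weight of the prefixes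
    -- reaching them: HR s if the last letter is positive, HL s if it is negative (for every offset).
    HR HL : ℕ → Carrier
    HR s = headProduct (s ∸ 1)
    HL s = pow t (s ∸ 1) * x (s ∸ 1) * y s * headProduct (s ∸ 1)

    head-split : ∀ s → 1 ≤ s → HR s + HL s ≈ headProduct s
    head-split (suc s) _ = trans (head-step-identity (headProduct s) (pow t s * x s * y (suc s))) (sym (prodL-fromTo-snoc 1 s headFactor (s≤s z≤n)))

    wrapTerm : ℕ → Carrier
    wrapTerm j = (x j + pow t (j ∸ 1) * x (j ∸ 1) * y j) * (pow t (j *ℕ (n ∸ j)) + pow t (n ∸ j ∸ 1) * y (suc j))
             * prodR 1 (j ∸ 1) headFactor * prodR (j +ℕ 2) n tailFactor

    level : ℕ → ℕ → Carrier
    level s k = sumL (upTo (suc k)) (λ l → HR s * transfer (seg l s true) k + HL s * transfer (seg l s false) k)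

    -- One level step: the segment states of size s either grow to size s+1 or wrap around,
    -- and the wrapped ones contribute exactly wrapTerm s.
    module LevelStep (s k : ℕ) (s1 : 1 ≤ s) (e : s +ℕ suc k ≡ n) where
      F : ℕ → Carrier
      F l = HR s * transfer (seg l s true) (suc k) + HL s * transfer (seg l s false) (suc k)
      A B : ℕ → Carrier
      A l = HR (suc s) * transfer (seg l (suc s) true) k
      B l = HL (suc s) * transfer (seg l (suc s) false) k
      -- The two wrapping contributions: -n appended to {1..s}, and +1 appended to {n-s+1..n}.
      T1 T2 W1 W2 : Carrier
      T1 = transfer (wrap s 1 false) k
      T2 = transfer (wrap 1 s true) k
      W1 = (HR s * x s + HL s) * y (suc s) * T1
      W2 = (HR s * x s + HL s) * pow t s * T2

      s<n : s < n
      s<n = P.subst (s <_) e (P.subst (s <_) (P.sym (NP.+-suc s k)) (s≤s (NP.m≤m+n s k)))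

      -- Offset 0: the left transition wraps around.
      F0 : F 0 ≈ W1 + A 0
      F0 rewrite ≡ᵇ-f {s} {n} (NP.<⇒≢ s<n) =
        trans (level-first-identity (HR s) (HL s) (x s) (y (suc s)) T1 (transfer (seg 0 (suc s) true) k))
              (+-cong refl (*-cong (head-split s s1) refl))

      neS : ∀ i → i < k → suc i +ℕ s ≢ n
      neS i ik eq = NP.<-irrefl (P.trans eq (P.sym e)) (P.subst (_< s +ℕ suc k) (NP.+-comm s (suc i))
                  (NP.+-monoʳ-< s (s≤s ik)))

      -- Middle offsets: both transitions stay segments.
      FS : ∀ i → i < k → F (suc i) ≈ B i + A (suc i)
      FS i ik rewrite ≡ᵇ-f {suc i +ℕ s} {n} (neS i ik) =
        trans (level-middle-identity (HR s) (HL s) (pow t s * x s * y (suc s)) (transfer (seg i (suc s) false) k) (transfer (seg (suc i) (suc s) true) k))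
              (+-cong (*-cong (*-cong refl (head-split s s1)) refl) (*-cong (head-split s s1) refl))

      -- Last offset: the segment ends at n, so the right transition wraps around.
      FK : F (suc k) ≈ B k + W2
      FK rewrite ≡ᵇ-t {suc k +ℕ s} {n} (P.trans (NP.+-comm (suc k) s) e) =
        trans (level-last-identity (HR s) (HL s) (pow t s * x s * y (suc s)) (transfer (seg k (suc s) false) k) (pow t s) (x s) T2)
              (+-cong (*-cong (*-cong refl (head-split s s1)) refl) refl)

      step0 : level s (suc k) ≈ level (suc s) k + (W1 + W2)
      step0 = begin
        sumL (upTo (suc (suc k))) F
          ≈⟨ sumL-upTo-cons (suc k) F ⟩
        F 0 + sumL (upTo (suc k)) (λ i → F (suc i))
          ≈⟨ +-cong refl (sumL-upTo-snoc k (λ i → F (suc i))) ⟩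
        F 0 + (sumL (upTo k) (λ i → F (suc i)) + F (suc k))
          ≈⟨ +-cong F0 (+-cong (trans (sumL-congᵤ k FS) (sumL-+ (upTo k) B (λ i → A (suc i)))) FK) ⟩
        (W1 + A 0) + ((sumL (upTo k) B + sumL (upTo k) (λ i → A (suc i))) + (B k + W2))
          ≈⟨ level-shuffle W1 (A 0) (sumL (upTo k) B) (sumL (upTo k) (λ i → A (suc i))) (B k) W2 ⟩
        ((A 0 + sumL (upTo k) (λ i → A (suc i))) + (sumL (upTo k) B + B k)) + (W1 + W2)
          ≈⟨ +-cong (+-cong (sym (sumL-upTo-cons k A)) (sym (sumL-upTo-snoc k B))) refl ⟩
        (sumL (upTo (suc k)) A + sumL (upTo (suc k)) B) + (W1 + W2)
          ≈⟨ +-cong (sym (sumL-+ (upTo (suc k)) A B)) refl ⟩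
        level (suc s) k + (W1 + W2) ∎

      nsk : n ∸ s ≡ suc k
      nsk = P.trans (P.cong (_∸ s) (P.sym e)) (NP.m+n∸m≡n s (suc k))

      Pi : Carrier
      Pi = prodR (suc (suc s)) n tailFactor

      wrapEq : W1 + W2 ≈ wrapTerm s
      wrapEq = begin
        (HR s * x s + HL s) * y (suc s) * T1 + (HR s * x s + HL s) * pow t s * T2
          ≈⟨ +-cong (*-cong refl (trans (transfer-wrap k s 1 false e1) (*-cong (≡⇒≈ (P.cong (pow t) (NP.*-identityʳ k)))
                                      (≡⇒≈ (P.cong (λ z → prodR (suc z) n tailFactor) (NP.+-comm s 1))))))
                    (*-cong refl (transfer-wrap k 1 s true e2)) ⟩
        (HR s * x s + HL s) * y (suc s) * (pow t k * Pi) + (HR s * x s + HL s) * pow t s * (pow t (k *ℕ s) * Pi)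
          ≈⟨ wrap-term-identity (headProduct (s ∸ 1)) (x s) (pow t (s ∸ 1) * x (s ∸ 1) * y s) (y (suc s)) (pow t k) (pow t s) (pow t (k *ℕ s)) Pi ⟩
        (x s + pow t (s ∸ 1) * x (s ∸ 1) * y s) * (pow t s * pow t (k *ℕ s) + pow t k * y (suc s)) * headProduct (s ∸ 1) * Pi
          ≈⟨ *-cong (*-cong (*-cong refl (+-cong (trans (sym (pow-+ t s (k *ℕ s))) (≡⇒≈ (P.cong (pow t) ex)))
                                                 (*-cong (≡⇒≈ (P.cong (pow t) (P.sym nk1))) refl))) refl)
                    (≡⇒≈ (P.cong (λ z → prodR z n tailFactor) (NP.+-comm 2 s))) ⟩
        wrapTerm s ∎
        where
        e1 : s +ℕ 1 +ℕ k ≡ n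
        e1 = P.trans (P.cong (_+ℕ k) (NP.+-comm s 1)) (P.trans (P.sym (NP.+-suc s k)) e)
        e2 : 1 +ℕ s +ℕ k ≡ n
        e2 = P.trans (P.sym (NP.+-suc s k)) e
        ex : s +ℕ k *ℕ s ≡ s *ℕ (n ∸ s)
        ex = P.trans (P.cong (s +ℕ_) (NP.*-comm k s)) (P.trans (P.sym (NP.*-suc s k)) (P.cong (s *ℕ_) (P.sym nsk)))
        nk1 : n ∸ s ∸ 1 ≡ k
        nk1 = P.cong (_∸ 1) nsk

      step : level s (suc k) ≈ level (suc s) k + wrapTerm s
      step = trans step0 (+-cong refl wrapEq)

    level-closed-form : ∀ k s → 1 ≤ s → s +ℕ k ≡ n → level s k ≈ headProduct n + sumR s (n ∸ 1) wrapTerm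
    level-closed-form zero s s1 e = begin
      HR s * 1# + HL s * 1# + 0#
        ≈⟨ trans (+-identityʳ _) (+-cong (*-identityʳ _) (*-identityʳ _)) ⟩
      HR s + HL s
        ≈⟨ head-split s s1 ⟩
      headProduct s
        ≈⟨ sym (+-identityʳ _) ⟩
      headProduct s + 0#
        ≈⟨ +-cong (≡⇒≈ (P.cong headProduct sn)) (≡⇒≈ (P.cong (λ l → sumL l wrapTerm) (P.sym (fromTo-nil s (n ∸ 1) lt)))) ⟩
      headProduct n + sumR s (n ∸ 1) wrapTerm ∎
      where
      sn : s ≡ n
      sn = P.trans (P.sym (NP.+-identityʳ s)) e
      lt : n ∸ 1 < s
      lt = P.subst (λ z → z ∸ 1 < s) sn (pred< s s1)
        where
        pred< : ∀ m → 1 ≤ m → m ∸ 1 < m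
        pred< (suc m) _ = NP.≤-refl
    level-closed-form (suc k) s s1 e = begin
      level s (suc k)
        ≈⟨ LevelStep.step s k s1 e ⟩
      level (suc s) k + wrapTerm s
        ≈⟨ +-cong (level-closed-form k (suc s) (s≤s z≤n) (P.trans (P.sym (NP.+-suc s k)) e)) refl ⟩
      (headProduct n + sumR (suc s) (n ∸ 1) wrapTerm) + wrapTerm s
        ≈⟨ trans (+-assoc _ _ _) (+-cong refl (+-comm _ _)) ⟩
      headProduct n + (wrapTerm s + sumR (suc s) (n ∸ 1) wrapTerm)
        ≈⟨ +-cong refl (sym (sumL-fromTo-cons s (n ∸ 1) wrapTerm sn1)) ⟩
      headProduct n + sumR s (n ∸ 1) wrapTerm ∎
      where
      sn1 : s ≤ n ∸ 1
      sn1 = NP.m+n≤o⇒m≤o∸n s (P.subst (_≤ n) (NP.+-comm 1 s) (P.subst (suc s ≤_) e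
              (P.subst (suc s ≤_) (P.sym (NP.+-suc s k)) (s≤s (NP.m≤m+n s k)))))

    inversion-identity : ∀ m → n ≡ suc (suc m) → sumL (SignedArc n) arcWeight ≈ headProduct n + sumR 1 (n ∸ 1) wrapTerm
    inversion-identity m eq = trans (sum-by-first-letter m eq) (trans conv (level-closed-form (suc m) 1 (s≤s z≤n) (P.sym eq)))
      where
      -- The one-letter prefixes ±(k+1) have weights y₁ and 1: together they form level 1.
      conv : sumL (upTo n) (λ k → weight (firstLetter false k ∷ []) 1 * transfer (seg k 1 false) (suc m))
           + sumL (upTo n) (λ k → weight (firstLetter true k ∷ []) 1 * transfer (seg k 1 true) (suc m)) ≈ level 1 (suc m)
      conv = begin
        sumL (upTo n) (λ k → weight (firstLetter false k ∷ []) 1 * transfer (seg k 1 false) (suc m))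
           + sumL (upTo n) (λ k → weight (firstLetter true k ∷ []) 1 * transfer (seg k 1 true) (suc m))
          ≈⟨ +-comm _ _ ⟩
        sumL (upTo n) (λ k → weight (firstLetter true k ∷ []) 1 * transfer (seg k 1 true) (suc m))
           + sumL (upTo n) (λ k → weight (firstLetter false k ∷ []) 1 * transfer (seg k 1 false) (suc m))
          ≈⟨ sym (sumL-+ (upTo n) _ _) ⟩
        sumL (upTo n) (λ k → weight (firstLetter true k ∷ []) 1 * transfer (seg k 1 true) (suc m) + weight (firstLetter false k ∷ []) 1 * transfer (seg k 1 false) (suc m))
          ≈⟨ sumL-cong (upTo n) (λ k → +-cong (*-cong unit-weight-pos refl) (*-cong (unit-weight-neg (y 1)) refl)) ⟩
        sumL (upTo n) (λ l → HR 1 * transfer (seg l 1 true) (suc m) + HL 1 * transfer (seg l 1 false) (suc m))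
          ≡⟨ P.cong (λ z → sumL (upTo z) (λ l → HR 1 * transfer (seg l 1 true) (suc m) + HL 1 * transfer (seg l 1 false) (suc m))) eq ⟩
        level 1 (suc m) ∎

  module DescentFormula (n : ℕ) (x₀ y : ℕ → Carrier) where

    open InversionFormula n 1# x₀ y using (inversion-identity; headProduct; wrapTerm; headFactor; tailFactor; x)
    open Weights n 1# x y using (arcWeight)

    -- At t = 1 both kinds of factors of the inversion formula become 1 + x_{i-1} y_i.
    unitFactor : ℕ → Carrier
    unitFactor i = 1# + x (i ∸ 1) * y i

    unitProduct : Carrier
    unitProduct = prodR 1 n unitFactor

    descentTerm : ℕ → Carrier
    descentTerm j = (x j + x (j ∸ 1) * y j) * (1# + y (suc j))

    unit-factor : ∀ k i → (1# + pow 1# k * x (i ∸ 1) * y i) ≈ unitFactor i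
    unit-factor k i = +-cong refl (trans (*-cong (*-cong (pow-1 k) refl) refl) (*-cong (*-identityˡ _) refl))

    unitProduct-split : ∀ j → suc (suc j) ≤ n →
      unitProduct ≈ prodR 1 j unitFactor * (unitFactor (suc j) * (unitFactor (suc (suc j)) * prodR (suc (suc (suc j))) n unitFactor))
    unitProduct-split j jn =
      trans (prodR-split 1 j n unitFactor (s≤s z≤n) (NP.≤-trans (NP.n≤1+n j) (NP.≤-trans (NP.n≤1+n (suc j)) jn)))
        (*-cong refl (trans (prodL-fromTo-cons (suc j) n unitFactor (NP.≤-trans (NP.n≤1+n (suc j)) jn))
          (*-cong refl (prodL-fromTo-cons (suc (suc j)) n unitFactor jn))))

    wrapTerm-at-one : ∀ (u v : ℕ → Carrier) j → 1 ≤ j → suc j ≤ n →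
      (unitFactor j * u j ≈ 1#) → (unitFactor (suc j) * v j ≈ 1#) →
      wrapTerm j ≈ unitProduct * (descentTerm j * (u j * v j))
    wrapTerm-at-one u v (suc j') (s≤s _) jn hu hv = begin
      wrapTerm j
        ≈⟨ *-cong (*-cong (*-cong (+-cong refl (trans (*-cong (*-cong (pow-1 (j ∸ 1)) refl) refl) (*-cong (*-identityˡ _) refl)))
                                  (+-cong (pow-1 (j *ℕ (n ∸ j))) (trans (*-cong (pow-1 (n ∸ j ∸ 1)) refl) (*-identityˡ _))))
                          (prodL-congᵣ (fromTo 1 j') (λ i _ → unit-factor (i ∸ 1) i)))
                  (trans (prodL-congᵣ (fromTo (j +ℕ 2) n) (λ i _ → unit-factor (n ∸ i) i)) (≡⇒≈ (P.cong (λ z → prodR z n unitFactor) (NP.+-comm j 2)))) ⟩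
      descentTerm j * prodR 1 j' unitFactor * prodR (suc (suc j)) n unitFactor
        ≈⟨ sym (trans (descent-term-regroup (prodR 1 j' unitFactor) (unitFactor j) (unitFactor (suc j)) (prodR (suc (suc j)) n unitFactor) (descentTerm j) (u j) (v j))
                 (trans (*-cong refl (*-cong hu hv)) (trans (*-cong refl (*-identityʳ 1#)) (*-identityʳ _)))) ⟩
      (prodR 1 j' unitFactor * (unitFactor j * (unitFactor (suc j) * prodR (suc (suc j)) n unitFactor))) * (descentTerm j * (u j * v j))
        ≈⟨ *-cong (sym (unitProduct-split j' jn)) refl ⟩
      unitProduct * (descentTerm j * (u j * v j)) ∎
      where
      j = suc j'

    descent-identity : ∀ m → n ≡ suc (suc m) → (u v : ℕ → Carrier) →
      (∀ j → 1 ≤ j → j ≤ n ∸ 1 → ((1# + x (j ∸ 1) * y j) * u j ≈ 1#) × ((1# + x j * y (suc j)) * v j ≈ 1#)) →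
      sumL (SignedArc n) (λ π → mono x (Des n π) * mono y (Neg n π)) ≈ unitProduct * (1# + sumR 1 (n ∸ 1) (λ j → descentTerm j * (u j * v j)))
    descent-identity m eq u v H = begin
      sumL (SignedArc n) (λ π → mono x (Des n π) * mono y (Neg n π))
        ≈⟨ sumL-cong (SignedArc n) (λ π → sym (trans (*-cong (*-cong (pow-1 (invAbs n π)) refl) refl) (*-cong (*-identityˡ _) refl))) ⟩
      sumL (SignedArc n) arcWeight
        ≈⟨ inversion-identity m eq ⟩
      headProduct n + sumR 1 (n ∸ 1) wrapTerm
        ≈⟨ +-cong (prodL-congᵣ (fromTo 1 n) (λ i _ → unit-factor (i ∸ 1) i))
                  (sumL-congᵣ (fromTo 1 (n ∸ 1)) (λ j mm → summand j (fromTo-∈⁻ mm))) ⟩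
      unitProduct + sumR 1 (n ∸ 1) (λ j → unitProduct * (descentTerm j * (u j * v j)))
        ≈⟨ +-cong (sym (*-identityʳ unitProduct)) (sym (sumL-*ˡ (fromTo 1 (n ∸ 1)) unitProduct _)) ⟩
      unitProduct * 1# + unitProduct * sumR 1 (n ∸ 1) (λ j → descentTerm j * (u j * v j))
        ≈⟨ sym (distribˡ unitProduct 1# _) ⟩
      unitProduct * (1# + sumR 1 (n ∸ 1) (λ j → descentTerm j * (u j * v j))) ∎
      where
      summand : ∀ j → (1 ≤ j) × (j ≤ n ∸ 1) → wrapTerm j ≈ unitProduct * (descentTerm j * (u j * v j))
      summand j (j1 , j2) = wrapTerm-at-one u v j j1 (P.subst (suc j ≤_) (P.sym eq) (s≤s (P.subst (j ≤_) (P.cong (_∸ 1) eq) j2)))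
        (proj₁ (H j j1 j2)) (proj₂ (H j j1 j2))

-- For n = 1 both sides evaluate, after unfolding the finite sums, to 1 + y₁.
theorem4p6 : ∀ {c ℓ} (R : CommutativeRing c ℓ) (n : ℕ) → 1 ≤ n →
    let open CommutativeRing R
        open RingOps R
    in (t : Carrier) (x₀ y : ℕ → Carrier) →
    let x = withX0 x₀
    in ((u v : ℕ → Carrier) →
        (∀ j → 1 ≤ j → j ≤ n ∸ 1 →
           ((1# + x (j ∸ 1) * y j) * u j ≈ 1#) × ((1# + x j * y (suc j)) * v j ≈ 1#)) →
        sumL (SignedArc n) (λ π → mono x (Des n π) * mono y (Neg n π))
          ≈ prodR 1 n (λ i → 1# + x (i ∸ 1) * y i)
            * (1# + sumR 1 (n ∸ 1) (λ j →
                 ((x j + x (j ∸ 1) * y j) * (1# + y (suc j))) * (u j * v j))))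
     × (sumL (SignedArc n) (λ π → pow t (invAbs n π) * mono x (Des n π) * mono y (Neg n π))
          ≈ prodR 1 n (λ i → 1# + pow t (i ∸ 1) * x (i ∸ 1) * y i)
            + sumR 1 (n ∸ 1) (λ j →
                (x j + pow t (j ∸ 1) * x (j ∸ 1) * y j)
                * (pow t (j *ℕ (n ∸ j)) + pow t (n ∸ j ∸ 1) * y (suc j))
                * prodR 1 (j ∸ 1) (λ i → 1# + pow t (i ∸ 1) * x (i ∸ 1) * y i)
                * prodR (j +ℕ 2) n (λ i → 1# + pow t (n ∸ i) * x (i ∸ 1) * y i)))
theorem4p6 R (suc zero) _ t x₀ y = (λ u v H → n1-descent-identity (y 1)) , n1-inversion-identity (y 1)
  where open Weighted.RingIdentities R
theorem4p6 R (suc (suc m)) _ t x₀ y =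
    (λ u v H → DescentFormula.descent-identity (suc (suc m)) x₀ y m P.refl u v H)
  , InversionFormula.inversion-identity (suc (suc m)) t x₀ y m P.refl
  where open Weighted R
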